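{- Let $n\ge 2$ with $n\equiv 1\pmod 3$, let $G$ be a finite abelian group of order $2n^2+2n+1$ with identity $e$, and let $T\subseteq G$ with $|T|=2n+1$ satisfy: (a) $e\in T$; (b) $T=T^{(-1)}$; (c) $T^2=2G-T^{(2)}+2n e$ in $\mathbb{Z}[G]$. Write $T^{(2)}T=\sum_{i\ge 0} iX_i$, where $X_i$ is the set of elements of $G$ whose coefficient in $T^{(2)}T$ equals $i$. Then $X_i=\emptyset$ for all $i\ge 4$, and $$|X_3|=\frac{4n(n-1)}{3},\quad |X_0|=\frac{2n(n-1)}{3},\quad |X_2|=4n,\quad |X_1|=1.$$
   Context: $\mathbb{Z}[G]$ is the integral group ring of $G$; a subset $A\subseteq G$ is identified with $\sum_{g\in A}g\in\mathbb{Z}[G]$, and $G$ also denotes $\sum_{g\in G}g$. For $A=\sum a_g g$ and $t\in\mathbb{Z}$, $A^{(t)}=\sum a_g g^t$. -}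

module Defs where

open import Level using (0ℓ)
open import Data.Bool using (Bool; true; false; if_then_else_)
open import Data.Nat using (ℕ; zero; suc)
open import Data.Integer using (ℤ; +_; -[1+_]; _+_; _*_; _-_; 0ℤ; 1ℤ)
import Data.Integer as ℤ
open import Data.List using (List; foldr; map; filter; length)
open import Data.List.Membership.Propositional using (_∈_)
open import Data.List.Relation.Unary.Unique.Propositional using (Unique)
open import Relation.Binary.PropositionalEquality using (_≡_)
open import Relation.Binary.Definitions using (DecidableEquality)
open import Relation.Nullary.Decidable using (does; ⌊_⌋)
open import Algebra.Structures using (IsAbelianGroup)

record FiniteAbelianGroup : Set₁ where
  field
    Carrier        : Set
    _∙_            : Carrier → Carrier → Carrier
    e              : Carrier
    _⁻¹            : Carrier → Carrier
    isAbelianGroup : IsAbelianGroup _≡_ _∙_ e _⁻¹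
    _≟_            : DecidableEquality Carrier
    elems          : List Carrier
    complete       : ∀ x → x ∈ elems
    unique         : Unique elems

  order : ℕ
  order = length elems

  powℕ : Carrier → ℕ → Carrier
  powℕ g zero    = e
  powℕ g (suc k) = g ∙ powℕ g k

  powℤ : Carrier → ℤ → Carrier
  powℤ g (+ k)     = powℕ g k
  powℤ g -[1+ k ]  = (powℕ g (suc k)) ⁻¹

  -- Elements of the integral group ring Z[G], given by their coefficient
  -- functions (G is finite, so every function is finitely supported).
  ZG : Set
  ZG = Carrier → ℤ

  sumℤ : List ℤ → ℤ
  sumℤ = foldr _+_ 0ℤ

  ΣG : (Carrier → ℤ) → ℤ
  ΣG f = sumℤ (map f elems)

  Subset : Set
  Subset = Carrier → Bool

  ∣_∣ : Subset → ℕ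
  ∣ A ∣ = length (filter (λ x → A x Data.Bool.≟ true) elems)
    where import Data.Bool

  -- identification of a subset A with Σ_{g ∈ A} g
  ⟦_⟧ : Subset → ZG
  ⟦ A ⟧ g = if A g then 1ℤ else 0ℤ

  𝔾 : ZG
  𝔾 _ = 1ℤ

  𝕖 : ZG
  𝕖 g = if ⌊ g ≟ e ⌋ then 1ℤ else 0ℤ

  _⊕_ : ZG → ZG → ZG
  (A ⊕ B) g = A g + B g

  _⊖_ : ZG → ZG → ZG
  (A ⊖ B) g = A g - B g

  _·_ : ℤ → ZG → ZG
  (k · A) g = k * A g

  _⊗_ : ZG → ZG → ZG
  (A ⊗ B) g = ΣG (λ a → A a * B ((a ⁻¹) ∙ g))

  -- A^{(t)} = Σ_h a_h h^t, i.e. (A^{(t)})_g = Σ_{h : h^t = g} a_h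
  _⁽_⁾ : ZG → ℤ → ZG
  (A ⁽ t ⁾) g = ΣG (λ h → if ⌊ powℤ h t ≟ g ⌋ then A h else 0ℤ)

  _≐_ : ZG → ZG → Set
  A ≐ B = ∀ g → A g ≡ B g

  X : ZG → ℕ → Subset
  X A i g = ⌊ A g ℤ.≟ + i ⌋

module Submission where

-- Write χ for the indicator function of T and S = T⁽²⁾T.  The hypotheses force squaring to be
-- injective on G and T ∩ T⁽²⁾ = {e}; with these one computes ΣS = (2n+1)² and ΣS² = 12n² + 4n + 1.
-- Moreover S = 2|T|G − T³ + 2nT, and T³ ≡ T⁽³⁾ (mod 3), so n ≡ 1 (mod 3) gives S ≡ 2(T + T⁽³⁾)
-- (mod 3).  Each term S_g² − 3S_g + 2[S_g ∈ {1,2}] is nonnegative, and by the congruence the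
-- number of g with S_g ∈ {1,2} is at most Σ(T + T⁽³⁾) − 1 = 4n + 1.  The two moments force every
-- term to vanish and the bound to be attained: S takes only the values 0, 1, 2, 3, the value 1
-- only at e and the value 2 exactly 4n times; ΣS and |G| then count the 3s and the 0s.

open import Defs

-- Integer arithmetic is opened only inside this module, leaving the natural-number operators
-- unambiguous in the statement of lemma3p4.
module _ where

  open import Level using (0ℓ)
  open import Algebra.Bundles using (AbelianGroup)
  import Algebra.Properties.AbelianGroup as AbelianGroupProperties
  import Algebra.Properties.CommutativeSemigroup as CommutativeSemigroupProperties
  open import Data.Bool using (Bool; true; false; if_then_else_)
  import Data.Bool as Bool
  open import Data.Empty using (⊥; ⊥-elim)
  open import Data.Integer using (ℤ; +_; -[1+_]; 0ℤ; 1ℤ; _+_; _*_; _-_; _≤_; +≤+; ∣_∣)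
  import Data.Integer as ℤ
  open import Data.Integer.Properties hiding (_≟_)
  open import Data.Integer.Tactic.RingSolver using (solve-∀)
  open import Data.List using (List; []; _∷_; foldr; map; filter; length)
  open import Data.List.Membership.Propositional using (_∈_)
  open import Data.List.Relation.Unary.Any using (here; there)
  open import Data.List.Relation.Unary.All as All using (All; []; _∷_)
  open import Data.List.Relation.Unary.AllPairs using ([]; _∷_)
  open import Data.List.Relation.Unary.Unique.Propositional using (Unique)
  open import Data.Nat using (ℕ; zero; suc; z≤n; s≤s)
  import Data.Nat as ℕ
  import Data.Nat.Properties as ℕ
  open import Data.Nat.DivMod using (m≡m%n+[m/n]*n; _/_)
  open import Data.Product using (∃-syntax; _×_; _,_; proj₁; proj₂; map₂)
  open import Function using (_∘_)
  open import Relation.Binary.PropositionalEquality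
  open import Relation.Nullary using (¬_; Dec; yes; no)
  open import Relation.Nullary.Decidable using (⌊_⌋; isYes≗does; dec-true; dec-false)

  ⌊⌋-true : ∀ {P : Set} (p? : Dec P) → P → ⌊ p? ⌋ ≡ true
  ⌊⌋-true p? p = trans (isYes≗does p?) (dec-true p? p)

  ⌊⌋-false : ∀ {P : Set} (p? : Dec P) → ¬ P → ⌊ p? ⌋ ≡ false
  ⌊⌋-false p? ¬p = trans (isYes≗does p?) (dec-false p? ¬p)

  𝟙 : Bool → ℤ
  𝟙 true  = 1ℤ
  𝟙 false = 0ℤ

  if-then-0≡𝟙* : ∀ b (v : ℤ) → (if b then v else 0ℤ) ≡ 𝟙 b * v
  if-then-0≡𝟙* true  v = sym (*-identityˡ v)
  if-then-0≡𝟙* false v = refl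

  if≡𝟙 : ∀ b → (if b then 1ℤ else 0ℤ) ≡ 𝟙 b
  if≡𝟙 true  = refl
  if≡𝟙 false = refl

  𝟙*-nonneg : ∀ b {x} → 0ℤ ≤ x → 0ℤ ≤ 𝟙 b * x
  𝟙*-nonneg true  {x} 0≤x = subst (0ℤ ≤_) (sym (*-identityˡ x)) 0≤x
  𝟙*-nonneg false     _   = ≤-refl

  *≢0⇒≢0ˡ : ∀ x y → x * y ≢ 0ℤ → x ≢ 0ℤ
  *≢0⇒≢0ˡ x y xy≢0 x≡0 = xy≢0 (trans (cong (_* y) x≡0) (*-zeroˡ y))

  *≢0⇒≢0ʳ : ∀ x y → x * y ≢ 0ℤ → y ≢ 0ℤ
  *≢0⇒≢0ʳ x y xy≢0 y≡0 = xy≢0 (trans (cong (x *_) y≡0) (*-zeroʳ x))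

  1+k≰k : ∀ {k} → ¬ (+ suc k ≤ + k)
  1+k≰k (+≤+ 1+k≤k) = ℕ.<-irrefl refl 1+k≤k

  𝟙-nonneg : ∀ b → 0ℤ ≤ 𝟙 b
  𝟙-nonneg true  = +≤+ z≤n
  𝟙-nonneg false = +≤+ z≤n

  𝟙≤1 : ∀ b → 𝟙 b ≤ 1ℤ
  𝟙≤1 true  = +≤+ (s≤s z≤n)
  𝟙≤1 false = +≤+ z≤n

  module _ {A : Set} where

    ∑ : List A → (A → ℤ) → ℤ
    ∑ xs f = foldr _+_ 0ℤ (map f xs)

    ∑-cong : ∀ xs {f g : A → ℤ} → (∀ x → f x ≡ g x) → ∑ xs f ≡ ∑ xs g
    ∑-cong []       f≡g = refl
    ∑-cong (x ∷ xs) f≡g = cong₂ _+_ (f≡g x) (∑-cong xs f≡g)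

    ∑-zero : ∀ xs → ∑ xs (λ _ → 0ℤ) ≡ 0ℤ
    ∑-zero []       = refl
    ∑-zero (x ∷ xs) = trans (+-identityˡ _) (∑-zero xs)

    ∑-one : ∀ xs → ∑ xs (λ _ → 1ℤ) ≡ + length xs
    ∑-one []       = refl
    ∑-one (x ∷ xs) = trans (cong (λ s → 1ℤ + s) (∑-one xs)) (sym (pos-+ 1 (length xs)))

    ∑-distrib-+ : ∀ xs (f g : A → ℤ) → ∑ xs (λ x → f x + g x) ≡ ∑ xs f + ∑ xs g
    ∑-distrib-+ []       f g = refl
    ∑-distrib-+ (x ∷ xs) f g =
      trans (cong (λ s → f x + g x + s) (∑-distrib-+ xs f g)) (+-interchange (f x) (g x) _ _)
      where
        +-interchange : ∀ a b c d → (a + b) + (c + d) ≡ (a + c) + (b + d)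
        +-interchange = solve-∀

    ∑-distribˡ : ∀ xs c (f : A → ℤ) → ∑ xs (λ x → c * f x) ≡ c * ∑ xs f
    ∑-distribˡ []       c f = sym (*-zeroʳ c)
    ∑-distribˡ (x ∷ xs) c f =
      trans (cong (λ s → c * f x + s) (∑-distribˡ xs c f)) (sym (*-distribˡ-+ c (f x) _))

    ∑-distribʳ : ∀ xs c (f : A → ℤ) → ∑ xs (λ x → f x * c) ≡ ∑ xs f * c
    ∑-distribʳ xs c f =
      trans (∑-cong xs (λ x → *-comm (f x) c)) (trans (∑-distribˡ xs c f) (*-comm c _))

    ∑-distrib-- : ∀ xs (f g : A → ℤ) → ∑ xs (λ x → f x - g x) ≡ ∑ xs f - ∑ xs g
    ∑-distrib-- []       f g = refl
    ∑-distrib-- (x ∷ xs) f g =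
      trans (cong (λ s → f x - g x + s) (∑-distrib-- xs f g)) (regroup (f x) (g x) _ _)
      where
        regroup : ∀ a b c d → (a - b) + (c - d) ≡ (a + c) - (b + d)
        regroup = solve-∀

    ∑-linear : ∀ xs (f g h : A → ℤ) a b →
      ∑ xs (λ x → a * f x - g x + b * h x) ≡ a * ∑ xs f - ∑ xs g + b * ∑ xs h
    ∑-linear xs f g h a b = begin
      ∑ xs (λ x → a * f x - g x + b * h x)             ≡⟨ ∑-distrib-+ xs _ _ ⟩
      ∑ xs (λ x → a * f x - g x) + ∑ xs (λ x → b * h x) ≡⟨ cong₂ _+_ (∑-distrib-- xs _ g) (∑-distribˡ xs b h) ⟩
      ∑ xs (λ x → a * f x) - ∑ xs g + b * ∑ xs h        ≡⟨ cong (λ s → s - ∑ xs g + b * ∑ xs h) (∑-distribˡ xs a f) ⟩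
      a * ∑ xs f - ∑ xs g + b * ∑ xs h                  ∎
      where open ≡-Reasoning

    ∑-mono-≤ : ∀ xs {f g : A → ℤ} → (∀ x → f x ≤ g x) → ∑ xs f ≤ ∑ xs g
    ∑-mono-≤ []       f≤g = ≤-refl
    ∑-mono-≤ (x ∷ xs) f≤g = +-mono-≤ (f≤g x) (∑-mono-≤ xs f≤g)

    ∑-nonneg : ∀ xs {f : A → ℤ} → (∀ x → 0ℤ ≤ f x) → 0ℤ ≤ ∑ xs f
    ∑-nonneg xs f≥0 = subst (_≤ ∑ xs _) (∑-zero xs) (∑-mono-≤ xs f≥0)

    module _ {f : A → ℤ} (f≥0 : ∀ x → 0ℤ ≤ f x) where

      ∑-≥-term : ∀ {x xs} → x ∈ xs → f x ≤ ∑ xs f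
      ∑-≥-term {x} {_ ∷ xs} (here refl) =
        subst (_≤ f x + ∑ xs f) (+-identityʳ (f x)) (+-monoʳ-≤ (f x) (∑-nonneg xs f≥0))
      ∑-≥-term {xs = y ∷ xs} (there x∈xs) =
        subst (_≤ f y + ∑ xs f) (+-identityˡ _) (+-mono-≤ (f≥0 y) (∑-≥-term x∈xs))

      ∑-≥-two-terms : ∀ {x y xs} → x ∈ xs → y ∈ xs → x ≢ y → f x + f y ≤ ∑ xs f
      ∑-≥-two-terms (here refl) (here refl) x≢y = ⊥-elim (x≢y refl)
      ∑-≥-two-terms {x} (here refl) (there y∈xs) _ = +-monoʳ-≤ (f x) (∑-≥-term y∈xs)
      ∑-≥-two-terms {x} {y} {_ ∷ xs} (there x∈xs) (here refl) _ =
        subst (_≤ f y + ∑ xs f) (+-comm (f y) (f x)) (+-monoʳ-≤ (f y) (∑-≥-term x∈xs))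
      ∑-≥-two-terms {x} {y} {z ∷ xs} (there x∈xs) (there y∈xs) x≢y =
        subst (_≤ f z + ∑ xs f) (+-identityˡ (f x + f y))
          (+-mono-≤ (f≥0 z) (∑-≥-two-terms x∈xs y∈xs x≢y))

      ∑-nonneg-zero : ∀ {x xs} → ∑ xs f ≡ 0ℤ → x ∈ xs → f x ≡ 0ℤ
      ∑-nonneg-zero ∑≡0 x∈xs = ≤-antisym (subst (_ ≤_) ∑≡0 (∑-≥-term x∈xs)) (f≥0 _)

    ∑≢0⇒∃≢0 : ∀ xs (f : A → ℤ) → ∑ xs f ≢ 0ℤ → ∃[ x ] f x ≢ 0ℤ
    ∑≢0⇒∃≢0 []       f ∑≢0 = ⊥-elim (∑≢0 refl)
    ∑≢0⇒∃≢0 (x ∷ xs) f ∑≢0 with f x ℤ.≟ 0ℤ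
    ... | no  fx≢0 = x , fx≢0
    ... | yes fx≡0 = ∑≢0⇒∃≢0 xs f (λ ∑xs≡0 → ∑≢0 (cong₂ _+_ fx≡0 ∑xs≡0))

    module _ {f : A → ℤ} {x : A} (support : ∀ y → f y ≢ 0ℤ → y ≡ x) where

      private
        vanishes-off : ∀ {y} → y ≢ x → f y ≡ 0ℤ
        vanishes-off {y} y≢x with f y ℤ.≟ 0ℤ
        ... | yes fy≡0 = fy≡0
        ... | no  fy≢0 = ⊥-elim (y≢x (support y fy≢0))

        ∑-off : ∀ {ys} → All (x ≢_) ys → ∑ ys f ≡ 0ℤ
        ∑-off []             = refl
        ∑-off (x≢y ∷ x≢ys) = cong₂ _+_ (vanishes-off (x≢y ∘ sym)) (∑-off x≢ys)

      ∑-concentrated : ∀ {xs} → Unique xs → x ∈ xs → ∑ xs f ≡ f x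
      ∑-concentrated (x≢xs ∷ _) (here refl) = trans (cong (λ s → f x + s) (∑-off x≢xs)) (+-identityʳ _)
      ∑-concentrated (y≢ys ∷ u) (there x∈ys) =
        trans (cong₂ _+_ (vanishes-off (All.lookup y≢ys x∈ys)) (∑-concentrated u x∈ys)) (+-identityˡ _)

    length-filter≡∑𝟙 : (P : A → Bool) (xs : List A) →
      + length (filter (λ x → P x Bool.≟ true) xs) ≡ ∑ xs (𝟙 ∘ P)
    length-filter≡∑𝟙 P []       = refl
    length-filter≡∑𝟙 P (x ∷ xs) with P x
    ... | true  = trans (pos-+ 1 _) (cong (λ s → 1ℤ + s) (length-filter≡∑𝟙 P xs))
    ... | false = trans (length-filter≡∑𝟙 P xs) (sym (+-identityˡ _))

  ∑-comm : ∀ {A B : Set} xs ys (f : A → B → ℤ) →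
    ∑ xs (λ x → ∑ ys (f x)) ≡ ∑ ys (λ y → ∑ xs (λ x → f x y))
  ∑-comm []       ys f = sym (∑-zero ys)
  ∑-comm (x ∷ xs) ys f =
    trans (cong (λ s → ∑ ys (f x) + s) (∑-comm xs ys f)) (sym (∑-distrib-+ ys (f x) _))

  module _ {A : Set} where

    ∑³ : List A → (A → A → A → ℤ) → ℤ
    ∑³ xs w = ∑ xs (λ b → ∑ xs (λ c → ∑ xs (w b c)))

    -- Expanding over x ∷ xs, the terms in which x occurs once or twice come in triples by symmetry.
    ∑³-symmetric≡diagonal-mod-3 : (w : A → A → A → ℤ) →
      (∀ b c d → w b c d ≡ w c b d) → (∀ b c d → w b c d ≡ w b d c) →
      ∀ xs → ∃[ k ] ∑³ xs w ≡ ∑ xs (λ b → w b b b) + + 3 * k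
    ∑³-symmetric≡diagonal-mod-3 w swap₁₂ swap₂₃ []       = 0ℤ , refl
    ∑³-symmetric≡diagonal-mod-3 w swap₁₂ swap₂₃ (x ∷ xs)
      with ∑³-symmetric≡diagonal-mod-3 w swap₁₂ swap₂₃ xs
    ... | k , ih = A₁ + C₂ + k , (begin
      ((w x x x + A₁) + ∑ xs (λ c → w x c x + ∑ xs (w x c)))
        + ∑ xs (λ b → (w b x x + ∑ xs (w b x)) + ∑ xs (λ c → w b c x + ∑ xs (w b c)))
                                            ≡⟨ cong₂ (λ p q → (w x x x + A₁) + p + q) one-in-xs two-in-xs ⟩
      ((w x x x + A₁) + (A₁ + C₂)) + ((A₁ + C₂) + (C₂ + ∑³ xs w))
                                            ≡⟨ cong (λ r → ((w x x x + A₁) + (A₁ + C₂)) + ((A₁ + C₂) + (C₂ + r))) ih ⟩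
      ((w x x x + A₁) + (A₁ + C₂)) + ((A₁ + C₂) + (C₂ + (D + + 3 * k)))
                                            ≡⟨ collect (w x x x) A₁ C₂ D k ⟩
      (w x x x + D) + + 3 * (A₁ + C₂ + k)    ∎)
      where
        open ≡-Reasoning
        A₁ = ∑ xs (w x x)
        C₂ = ∑ xs (λ c → ∑ xs (w x c))
        D  = ∑ xs (λ b → w b b b)

        collect : ∀ a p q r k → ((a + p) + (p + q)) + ((p + q) + (q + (r + + 3 * k)))
                              ≡ (a + r) + + 3 * (p + q + k)
        collect = solve-∀

        one-in-xs : ∑ xs (λ c → w x c x + ∑ xs (w x c)) ≡ A₁ + C₂
        one-in-xs = trans (∑-distrib-+ xs _ _) (cong (_+ C₂) (∑-cong xs (λ c → swap₂₃ x c x)))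

        two-in-xs : ∑ xs (λ b → (w b x x + ∑ xs (w b x)) + ∑ xs (λ c → w b c x + ∑ xs (w b c)))
                  ≡ (A₁ + C₂) + (C₂ + ∑³ xs w)
        two-in-xs = trans (∑-distrib-+ xs _ _) (cong₂ _+_
          (trans (∑-distrib-+ xs _ _) (cong₂ _+_
            (∑-cong xs (λ b → trans (swap₁₂ b x x) (swap₂₃ x b x)))
            (∑-cong xs (λ b → ∑-cong xs (swap₁₂ b x)))))
          (trans (∑-cong xs (λ b → ∑-distrib-+ xs _ _)) (trans (∑-distrib-+ xs _ _)
            (cong (_+ ∑³ xs w) (∑-cong xs (λ b → ∑-cong xs (λ c → trans (swap₂₃ b c x) (swap₁₂ b x c))))))))

  module FiniteAbelianGroupProperties (𝒢 : FiniteAbelianGroup) where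

    open FiniteAbelianGroup 𝒢

    abelianGroup : AbelianGroup 0ℓ 0ℓ
    abelianGroup = record
      { Carrier = Carrier ; _≈_ = _≡_ ; _∙_ = _∙_ ; ε = e ; _⁻¹ = _⁻¹
      ; isAbelianGroup = isAbelianGroup }

    open AbelianGroup abelianGroup public
      using (assoc; comm; identityˡ; identityʳ; inverseˡ; inverseʳ)
    open AbelianGroupProperties abelianGroup public
      using (⁻¹-involutive; ⁻¹-injective; ε⁻¹≈ε; inverseʳ-unique; ⁻¹-∙-comm; ⁻¹-anti-homo-\\; x∙y⁻¹≈ε⇒x≈y;
             \\-leftDividesˡ; \\-leftDividesʳ; y≈x\\z)
    open CommutativeSemigroupProperties (AbelianGroup.commutativeSemigroup abelianGroup) public
      using (interchange; x∙yz≈y∙xz; x∙yz≈x∙zy)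

    infix 30 _²
    _² : Carrier → Carrier
    x ² = powℕ x 2

    ²≡∙ : ∀ x → x ² ≡ x ∙ x
    ²≡∙ x = cong (x ∙_) (identityʳ x)

    ²-∙ : ∀ x y → (x ∙ y) ² ≡ x ² ∙ y ²
    ²-∙ x y = trans (²≡∙ (x ∙ y)) (trans (interchange x y x y) (sym (cong₂ _∙_ (²≡∙ x) (²≡∙ y))))

    ²-⁻¹ : ∀ x → (x ⁻¹) ² ≡ (x ²) ⁻¹
    ²-⁻¹ x = trans (²≡∙ (x ⁻¹)) (trans (⁻¹-∙-comm x x) (cong _⁻¹ (sym (²≡∙ x))))

    e² : e ² ≡ e
    e² = trans (²≡∙ e) (identityˡ e)

    [_≈_] : Carrier → Carrier → ℤ
    [ a ≈ b ] = 𝟙 ⌊ a ≟ b ⌋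

    [≈]-≡ : ∀ {a b} → a ≡ b → [ a ≈ b ] ≡ 1ℤ
    [≈]-≡ {a} {b} a≡b = cong 𝟙 (⌊⌋-true (a ≟ b) a≡b)

    [≈]-≢ : ∀ {a b} → a ≢ b → [ a ≈ b ] ≡ 0ℤ
    [≈]-≢ {a} {b} a≢b = cong 𝟙 (⌊⌋-false (a ≟ b) a≢b)

    [≈]*≢0⇒≡ : ∀ {a b} v → [ a ≈ b ] * v ≢ 0ℤ → a ≡ b
    [≈]*≢0⇒≡ {a} {b} v ≢0 with a ≟ b
    ... | yes a≡b = a≡b
    ... | no  _   = ⊥-elim (≢0 refl)

    ΣG-concentrated : ∀ f x → (∀ y → f y ≢ 0ℤ → y ≡ x) → ΣG f ≡ f x
    ΣG-concentrated f x support = ∑-concentrated support unique (complete x)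

    ΣG-[≈] : ∀ (φ ψ : Carrier → Carrier) (f : Carrier → ℤ) x →
      (∀ y → φ y ≡ ψ y → y ≡ x) → φ x ≡ ψ x → ΣG (λ y → [ φ y ≈ ψ y ] * f y) ≡ f x
    ΣG-[≈] φ ψ f x solution φx≡ψx =
      trans (ΣG-concentrated _ x (λ y ≢0 → solution y ([≈]*≢0⇒≡ (f y) ≢0)))
            (trans (cong (_* f x) ([≈]-≡ φx≡ψx)) (*-identityˡ (f x)))

    ΣG-[≈e] : ΣG (λ g → [ g ≈ e ]) ≡ 1ℤ
    ΣG-[≈e] = trans (∑-cong elems (λ g → sym (*-identityʳ [ g ≈ e ])))
                    (ΣG-[≈] (λ g → g) (λ _ → e) (λ _ → 1ℤ) e (λ _ g≡e → g≡e) refl)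

    ΣG-reindex : ∀ (σ τ : Carrier → Carrier) → (∀ g → σ (τ g) ≡ g) → (∀ h → τ (σ h) ≡ h) →
      ∀ F → ΣG (F ∘ σ) ≡ ΣG F
    ΣG-reindex σ τ στ τσ F = sym (begin
      ΣG F                                         ≡⟨ ∑-cong elems (λ g → sym (ΣG-[≈] σ (λ _ → g) (λ _ → F g) (τ g)
                                                        (λ h σh≡g → trans (sym (τσ h)) (cong τ σh≡g)) (στ g))) ⟩
      ΣG (λ g → ΣG (λ h → [ σ h ≈ g ] * F g))     ≡⟨ ∑-comm elems elems _ ⟩
      ΣG (λ h → ΣG (λ g → [ σ h ≈ g ] * F g))     ≡⟨ ∑-cong elems (λ h → ΣG-[≈] (λ _ → σ h) (λ g → g) F (σ h)
                                                        (λ g σh≡g → sym σh≡g) refl) ⟩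
      ΣG (F ∘ σ)                                   ∎)
      where open ≡-Reasoning

    ΣG-translate : ∀ c F → ΣG (λ g → F (c ∙ g)) ≡ ΣG F
    ΣG-translate c F = ΣG-reindex (c ∙_) ((c ⁻¹) ∙_) (\\-leftDividesˡ c) (\\-leftDividesʳ c) F

    module _ {f : Carrier → ℤ} (f≥0 : ∀ g → 0ℤ ≤ f g) where

      ΣG-nonneg : 0ℤ ≤ ΣG f
      ΣG-nonneg = ∑-nonneg elems f≥0

      ΣG-≥-term : ∀ x → f x ≤ ΣG f
      ΣG-≥-term x = ∑-≥-term f≥0 (complete x)

      ΣG-≥-two-terms : ∀ {x y} → x ≢ y → f x + f y ≤ ΣG f
      ΣG-≥-two-terms x≢y = ∑-≥-two-terms f≥0 (complete _) (complete _) x≢y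

      ΣG-nonneg-zero : ΣG f ≡ 0ℤ → ∀ g → f g ≡ 0ℤ
      ΣG-nonneg-zero ΣG≡0 g = ∑-nonneg-zero f≥0 ΣG≡0 (complete g)

  oneOrTwo : ℕ → Bool
  oneOrTwo 1 = true
  oneOrTwo 2 = true
  oneOrTwo _ = false

  -- m² - 3m vanishes at 0 and 3 and equals -2 at 1 and 2, so the defect vanishes exactly on {0,1,2,3}.
  defect : ℕ → ℤ
  defect m = + m * + m - + 3 * + m + + 2 * 𝟙 (oneOrTwo m)

  defect-4+ : ∀ k → defect (4 ℕ.+ k) ≡ (+ 4 + + k) * (+ 1 + + k)
  defect-4+ k = factor (+ k)
    where
      factor : ∀ x → (+ 4 + x) * (+ 4 + x) - + 3 * (+ 4 + x) + + 2 * 0ℤ ≡ (+ 4 + x) * (+ 1 + x)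
      factor = solve-∀

  defect-nonneg : ∀ m → 0ℤ ≤ defect m
  defect-nonneg 0 = +≤+ z≤n
  defect-nonneg 1 = +≤+ z≤n
  defect-nonneg 2 = +≤+ z≤n
  defect-nonneg 3 = +≤+ z≤n
  defect-nonneg (suc (suc (suc (suc k)))) = subst (0ℤ ≤_) (sym (defect-4+ k)) (+≤+ z≤n)

  mod-3-absurd : ∀ a b j {r} → a ≡ b + + 3 * j → ∣ a - b ∣ ≡ suc r → r ℕ.< 2 → ⊥
  mod-3-absurd a b j a≡b+3j ∣a-b∣≡1+r r<2 =
    3∤ ∣ j ∣ (trans (ℕ.*-comm ∣ j ∣ 3) (trans (sym (abs-* (+ 3) j))
      (trans (cong ∣_∣ (isolate a b (+ 3 * j) a≡b+3j)) ∣a-b∣≡1+r))) r<2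
    where
      isolate : ∀ a b d → a ≡ b + d → d ≡ a - b
      isolate a b d refl = lemma b d
        where
          lemma : ∀ b d → d ≡ b + d - b
          lemma = solve-∀
      3∤ : ∀ {r} x → x ℕ.* 3 ≡ suc r → r ℕ.< 2 → ⊥
      3∤ (suc y) refl (s≤s (s≤s ()))

  oneOrTwo≤ : ∀ m {c} j → 0ℤ ≤ c → + m ≡ + 2 * c + + 3 * j → 𝟙 (oneOrTwo m) ≤ c
  oneOrTwo≤ 0 j c≥0 _ = c≥0
  oneOrTwo≤ 1 {+ 0} j _ eq = ⊥-elim (mod-3-absurd (+ 1) 0ℤ j eq refl (s≤s z≤n))
  oneOrTwo≤ 1 {+ suc c} j _ _ = +≤+ (s≤s z≤n)
  oneOrTwo≤ 2 {+ 0} j _ eq = ⊥-elim (mod-3-absurd (+ 2) 0ℤ j eq refl (s≤s (s≤s z≤n)))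
  oneOrTwo≤ 2 {+ suc c} j _ _ = +≤+ (s≤s z≤n)
  oneOrTwo≤ (suc (suc (suc m))) j c≥0 _ = c≥0

  nonneg-sum-zero : ∀ {x y} → 0ℤ ≤ x → 0ℤ ≤ y → x + + 2 * y ≡ 0ℤ → x ≡ 0ℤ × y ≡ 0ℤ
  nonneg-sum-zero {+ a} {+ b} (+≤+ _) (+≤+ _) eq =
    cong +_ (ℕ.m+n≡0⇒m≡0 a a+2b≡0) , cong +_ (ℕ.m+n≡0⇒m≡0 b (ℕ.m+n≡0⇒n≡0 a a+2b≡0))
    where
      a+2b≡0 = +-injective (trans (pos-+ a (2 ℕ.* b)) (trans (cong (λ z → + a + z) (pos-* 2 b)) eq))

  classify : ∀ m d {c} j → defect m ≡ 0ℤ → c ≡ 𝟙 (oneOrTwo m) + 𝟙 d →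
    + m ≡ + 2 * c + + 3 * j → (d ≡ true → + 2 ≤ c) →
    m ℕ.≤ 3 × 𝟙 ⌊ + m ℤ.≟ + 1 ⌋ ≡ 𝟙 d × 𝟙 ⌊ + m ℤ.≟ + 2 ⌋ ≡ c - + 2 * 𝟙 d
  classify 0 true  j _ refl _  2≤c with 2≤c refl
  ... | +≤+ (s≤s ())
  classify 0 false j _ refl _  _   = z≤n , refl , refl
  classify 1 true  j _ refl _  _   = s≤s z≤n , refl , refl
  classify 1 false j _ refl eq _   = ⊥-elim (mod-3-absurd (+ 1) (+ 2) j eq refl (s≤s z≤n))
  classify 2 true  j _ refl eq _   = ⊥-elim (mod-3-absurd (+ 2) (+ 4) j eq refl (s≤s (s≤s z≤n)))
  classify 2 false j _ refl _  _   = s≤s (s≤s z≤n) , refl , refl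
  classify 3 true  j _ refl _  2≤c with 2≤c refl
  ... | +≤+ (s≤s ())
  classify 3 false j _ refl _  _   = s≤s (s≤s (s≤s z≤n)) , refl , refl
  classify (suc (suc (suc (suc k)))) d j defect≡0 _ _ _ with trans (sym (defect-4+ k)) defect≡0
  ... | ()

  ≟-false-< : ∀ {m i} → m ℕ.< i → ⌊ + m ℤ.≟ + i ⌋ ≡ false
  ≟-false-< {m} {i} m<i = ⌊⌋-false (+ m ℤ.≟ + i) (λ +m≡+i → ℕ.<-irrefl (+-injective +m≡+i) m<i)

  module _ {m : ℕ} where

    private
      [_≟_] : ℕ → ℕ → ℤ
      [ a ≟ b ] = 𝟙 ⌊ + a ℤ.≟ + b ⌋

    small-value-expansion : m ℕ.≤ 3 → + m ≡ [ m ≟ 1 ] + + 2 * [ m ≟ 2 ] + + 3 * [ m ≟ 3 ]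
    small-value-expansion z≤n                 = refl
    small-value-expansion (s≤s z≤n)           = refl
    small-value-expansion (s≤s (s≤s z≤n))     = refl
    small-value-expansion (s≤s (s≤s (s≤s z≤n))) = refl

    small-value-partition : m ℕ.≤ 3 → 1ℤ ≡ [ m ≟ 0 ] + [ m ≟ 1 ] + [ m ≟ 2 ] + [ m ≟ 3 ]
    small-value-partition z≤n                 = refl
    small-value-partition (s≤s z≤n)           = refl
    small-value-partition (s≤s (s≤s z≤n))     = refl
    small-value-partition (s≤s (s≤s (s≤s z≤n))) = refl

  module _ (𝒢 : FiniteAbelianGroup) where

    open FiniteAbelianGroup 𝒢 hiding (∣_∣)
    open FiniteAbelianGroupProperties 𝒢

    module ValueDistribution (S c : Carrier → ℤ) (S≥0 : ∀ g → 0ℤ ≤ S g) (c≥0 : ∀ g → 0ℤ ≤ c g)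
             (S≡2c-mod-3 : ∀ g → ∃[ j ] S g ≡ + 2 * c g + + 3 * j) (2≤c-e : + 2 ≤ c e)
             (moments : ΣG (λ g → S g * S g) + + 2 * ΣG c ≡ + 3 * ΣG S + + 2) where

      count : ℕ → ℤ
      count i = ΣG (λ g → 𝟙 ⌊ S g ℤ.≟ + i ⌋)

      private
        s : Carrier → ℕ
        s g = ∣ S g ∣

        +s≡S : ∀ g → + s g ≡ S g
        +s≡S g = 0≤i⇒+∣i∣≡i (S≥0 g)

        u : Carrier → ℤ
        u g = 𝟙 (oneOrTwo (s g))

        u+[≈e]≤c : ∀ g → u g + [ g ≈ e ] ≤ c g
        u+[≈e]≤c g with g ≟ e | S≡2c-mod-3 g
        ... | yes refl | _      = ≤-trans (+-monoˡ-≤ 1ℤ (𝟙≤1 (oneOrTwo (s e)))) 2≤c-e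
        ... | no  _    | j , eq =
          subst (_≤ c g) (sym (+-identityʳ (u g))) (oneOrTwo≤ (s g) j (c≥0 g) (trans (+s≡S g) eq))

        excess : Carrier → ℤ
        excess g = c g - (u g + [ g ≈ e ])

        -- The weight 2 on the excess makes the terms 2 u g cancel.
        slack : Carrier → ℤ
        slack g = defect (s g) + + 2 * excess g

        slack-nonneg : ∀ g → 0ℤ ≤ slack g
        slack-nonneg g = +-mono-≤ (defect-nonneg (s g)) (*-monoˡ-≤-nonNeg (+ 2) (i≤j⇒0≤j-i (u+[≈e]≤c g)))

        slack≡ : ∀ g → slack g ≡ (S g * S g + + 2 * c g) - (+ 3 * S g + + 2 * [ g ≈ e ])
        slack≡ g = trans (rearrange (+ s g) (u g) (c g) [ g ≈ e ])
                         (cong (λ x → (x * x + + 2 * c g) - (+ 3 * x + + 2 * [ g ≈ e ])) (+s≡S g))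
          where
            rearrange : ∀ x u c d → x * x - + 3 * x + + 2 * u + + 2 * (c - (u + d))
                                  ≡ (x * x + + 2 * c) - (+ 3 * x + + 2 * d)
            rearrange = solve-∀

        ΣG-slack : ΣG slack ≡ 0ℤ
        ΣG-slack = begin
          ΣG slack                                                          ≡⟨ ∑-cong elems slack≡ ⟩
          ΣG (λ g → (S g * S g + + 2 * c g) - (+ 3 * S g + + 2 * [ g ≈ e ])) ≡⟨ ∑-distrib-- elems _ _ ⟩
          ΣG (λ g → S g * S g + + 2 * c g) - ΣG (λ g → + 3 * S g + + 2 * [ g ≈ e ])
                    ≡⟨ cong₂ _-_ (trans (∑-distrib-+ elems _ _) (cong (λ z → ΣG (λ g → S g * S g) + z) (∑-distribˡ elems (+ 2) c)))
                                 (trans (∑-distrib-+ elems _ _) (cong₂ _+_ (∑-distribˡ elems (+ 3) S)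
                                                               (trans (∑-distribˡ elems (+ 2) _) (cong (+ 2 *_) ΣG-[≈e])))) ⟩
          (ΣG (λ g → S g * S g) + + 2 * ΣG c) - (+ 3 * ΣG S + + 2)           ≡⟨ cong (_- (+ 3 * ΣG S + + 2)) moments ⟩
          (+ 3 * ΣG S + + 2) - (+ 3 * ΣG S + + 2)                            ≡⟨ +-inverseʳ (+ 3 * ΣG S + + 2) ⟩
          0ℤ                                                                ∎
          where open ≡-Reasoning

        tight : ∀ g → defect (s g) ≡ 0ℤ × c g ≡ u g + [ g ≈ e ]
        tight g with nonneg-sum-zero (defect-nonneg (s g)) (i≤j⇒0≤j-i (u+[≈e]≤c g))
                                     (ΣG-nonneg-zero slack-nonneg ΣG-slack g)
        ... | defect≡0 , excess≡0 = defect≡0 , i-j≡0⇒i≡j _ _ excess≡0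

      value-distribution : ∀ g → ∣ S g ∣ ℕ.≤ 3
        × 𝟙 ⌊ S g ℤ.≟ + 1 ⌋ ≡ [ g ≈ e ] × 𝟙 ⌊ S g ℤ.≟ + 2 ⌋ ≡ c g - + 2 * [ g ≈ e ]
      value-distribution g with S≡2c-mod-3 g | tight g
      ... | j , S≡ | defect≡0 , c≡ =
        subst (λ x → ∣ S g ∣ ℕ.≤ 3 × 𝟙 ⌊ x ℤ.≟ + 1 ⌋ ≡ [ g ≈ e ] × 𝟙 ⌊ x ℤ.≟ + 2 ⌋ ≡ c g - + 2 * [ g ≈ e ])
          (+s≡S g)
          (classify (s g) ⌊ g ≟ e ⌋ j defect≡0 c≡ (trans (+s≡S g) S≡) 2≤c)
        where
          2≤c : ⌊ g ≟ e ⌋ ≡ true → + 2 ≤ c g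
          2≤c _ with g ≟ e
          ... | yes refl = 2≤c-e

      private
        [S≟_] : ℕ → Carrier → ℤ
        [S≟ i ] g = 𝟙 ⌊ S g ℤ.≟ + i ⌋

        S≡expansion : ∀ g → S g ≡ [S≟ 1 ] g + + 2 * [S≟ 2 ] g + + 3 * [S≟ 3 ] g
        S≡expansion g =
          subst (λ x → x ≡ 𝟙 ⌊ x ℤ.≟ + 1 ⌋ + + 2 * 𝟙 ⌊ x ℤ.≟ + 2 ⌋ + + 3 * 𝟙 ⌊ x ℤ.≟ + 3 ⌋) (+s≡S g)
            (small-value-expansion (proj₁ (value-distribution g)))

        1≡partition : ∀ g → 1ℤ ≡ [S≟ 0 ] g + [S≟ 1 ] g + [S≟ 2 ] g + [S≟ 3 ] g
        1≡partition g =
          subst (λ x → 1ℤ ≡ 𝟙 ⌊ x ℤ.≟ + 0 ⌋ + 𝟙 ⌊ x ℤ.≟ + 1 ⌋ + 𝟙 ⌊ x ℤ.≟ + 2 ⌋ + 𝟙 ⌊ x ℤ.≟ + 3 ⌋) (+s≡S g)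
            (small-value-partition (proj₁ (value-distribution g)))

      no-value-≥4 : ∀ i → 4 ℕ.≤ i → ∀ g → ⌊ S g ℤ.≟ + i ⌋ ≡ false
      no-value-≥4 i 4≤i g = subst (λ x → ⌊ x ℤ.≟ + i ⌋ ≡ false) (+s≡S g)
        (≟-false-< (ℕ.≤-trans (s≤s (proj₁ (value-distribution g))) 4≤i))

      count-1 : count 1 ≡ 1ℤ
      count-1 = trans (∑-cong elems (proj₁ ∘ proj₂ ∘ value-distribution)) ΣG-[≈e]

      count-2 : count 2 ≡ ΣG c - + 2
      count-2 = begin
        count 2                                ≡⟨ ∑-cong elems (proj₂ ∘ proj₂ ∘ value-distribution) ⟩
        ΣG (λ g → c g - + 2 * [ g ≈ e ])       ≡⟨ ∑-distrib-- elems c _ ⟩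
        ΣG c - ΣG (λ g → + 2 * [ g ≈ e ])      ≡⟨ cong (λ z → ΣG c - z) (trans (∑-distribˡ elems (+ 2) _) (cong (+ 2 *_) ΣG-[≈e])) ⟩
        ΣG c - + 2                             ∎
        where open ≡-Reasoning

      ΣG-S≡counts : ΣG S ≡ count 1 + + 2 * count 2 + + 3 * count 3
      ΣG-S≡counts = begin
        ΣG S                                                           ≡⟨ ∑-cong elems S≡expansion ⟩
        ΣG (λ g → [S≟ 1 ] g + + 2 * [S≟ 2 ] g + + 3 * [S≟ 3 ] g)        ≡⟨ ∑-distrib-+ elems _ _ ⟩
        ΣG (λ g → [S≟ 1 ] g + + 2 * [S≟ 2 ] g) + ΣG (λ g → + 3 * [S≟ 3 ] g)
                                   ≡⟨ cong₂ _+_ (trans (∑-distrib-+ elems _ _) (cong (λ z → count 1 + z) (∑-distribˡ elems (+ 2) _)))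
                                                (∑-distribˡ elems (+ 3) _) ⟩
        count 1 + + 2 * count 2 + + 3 * count 3                        ∎
        where open ≡-Reasoning

      order≡counts : + order ≡ count 0 + count 1 + count 2 + count 3
      order≡counts = begin
        + order                                                   ≡⟨ sym (∑-one elems) ⟩
        ΣG (λ _ → 1ℤ)                                             ≡⟨ ∑-cong elems 1≡partition ⟩
        ΣG (λ g → [S≟ 0 ] g + [S≟ 1 ] g + [S≟ 2 ] g + [S≟ 3 ] g)   ≡⟨ ∑-distrib-+ elems _ _ ⟩
        ΣG (λ g → [S≟ 0 ] g + [S≟ 1 ] g + [S≟ 2 ] g) + count 3     ≡⟨ cong (_+ count 3) (trans (∑-distrib-+ elems _ _)
                                                                         (cong (_+ count 2) (∑-distrib-+ elems _ _))) ⟩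
        count 0 + count 1 + count 2 + count 3                     ∎
        where open ≡-Reasoning

  k*n*n-k*n≡k*n*[n∸1] : ∀ k n → + k * + n * + n - + k * + n ≡ + (k ℕ.* n ℕ.* (n ℕ.∸ 1))
  k*n*n-k*n≡k*n*[n∸1] k zero rewrite *-zeroʳ (+ k) | ℕ.*-zeroʳ k = refl
  k*n*n-k*n≡k*n*[n∸1] k (suc m) =
    trans (factor (+ k) (+ m)) (sym (trans (pos-* (k ℕ.* suc m) m) (cong (_* + m) (pos-* k (suc m)))))
    where
      factor : ∀ K M → K * (1ℤ + M) * (1ℤ + M) - K * (1ℤ + M) ≡ K * (1ℤ + M) * M
      factor = solve-∀

  3*-injective : ∀ {c r : ℕ} {x : ℤ} → + c ≡ x → + 3 * x ≡ + r → 3 ℕ.* c ≡ r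
  3*-injective {c} c≡x 3x≡r = +-injective (trans (pos-* 3 c) (trans (cong (+ 3 *_) c≡x) 3x≡r))

  module Notation (𝒢 : FiniteAbelianGroup) (n : ℕ) (T : FiniteAbelianGroup.Subset 𝒢) where

    open FiniteAbelianGroup 𝒢 renaming (∣_∣ to card)
    open FiniteAbelianGroupProperties 𝒢

    N : ℤ
    N = + n

    χ : Carrier → ℤ
    χ = ⟦ T ⟧

    χ≡1 : ∀ {g} → T g ≡ true → χ g ≡ 1ℤ
    χ≡1 {g} g∈T rewrite g∈T = refl

    χ≢0⇒∈T : ∀ {g} → χ g ≢ 0ℤ → T g ≡ true
    χ≢0⇒∈T {g} χg≢0 with T g
    ... | true  = refl
    ... | false = ⊥-elim (χg≢0 refl)

    χ-idem : ∀ g → χ g * χ g ≡ χ g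
    χ-idem g with T g
    ... | true  = refl
    ... | false = refl

    χ-nonneg : ∀ g → 0ℤ ≤ χ g
    χ-nonneg g = subst (0ℤ ≤_) (sym (if≡𝟙 (T g))) (𝟙-nonneg (T g))

    χ*-nonneg : ∀ g {x} → 0ℤ ≤ x → 0ℤ ≤ χ g * x
    χ*-nonneg g {x} 0≤x = subst (λ c → 0ℤ ≤ c * x) (sym (if≡𝟙 (T g))) (𝟙*-nonneg (T g) 0≤x)

    χ*χ-nonneg : ∀ a b → 0ℤ ≤ χ a * χ b
    χ*χ-nonneg a b = χ*-nonneg a (χ-nonneg b)

    [≈]*χ-nonneg : ∀ x y h → 0ℤ ≤ [ x ≈ y ] * χ h
    [≈]*χ-nonneg x y h = 𝟙*-nonneg ⌊ x ≟ y ⌋ (χ-nonneg h)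

    χ⁽²⁾ : Carrier → ℤ
    χ⁽²⁾ g = ΣG (λ h → [ h ² ≈ g ] * χ h)

    χ² : Carrier → ℤ
    χ² = ⟦ T ⟧ ⊗ ⟦ T ⟧

    χ⁽²⁾-term : ∀ {h g} → T h ≡ true → h ² ≡ g → [ h ² ≈ g ] * χ h ≡ 1ℤ
    χ⁽²⁾-term h∈T h²≡g = cong₂ _*_ ([≈]-≡ h²≡g) (χ≡1 h∈T)

    χ²-term : ∀ {a b} → T a ≡ true → T b ≡ true → χ a * χ ((a ⁻¹) ∙ (a ∙ b)) ≡ 1ℤ
    χ²-term {a} {b} a∈T b∈T = cong₂ _*_ (χ≡1 a∈T) (trans (cong χ (\\-leftDividesʳ a b)) (χ≡1 b∈T))

    1≤χ² : ∀ {a b} → T a ≡ true → T b ≡ true → 1ℤ ≤ χ² (a ∙ b)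
    1≤χ² {a} {b} a∈T b∈T = subst (_≤ χ² (a ∙ b)) (χ²-term a∈T b∈T) (ΣG-≥-term (λ x → χ*χ-nonneg x _) a)

    module Consequences (card-T : card T ≡ 2 ℕ.* n ℕ.+ 1) (e∈T : T e ≡ true)
             (T-symmetric : ⟦ T ⟧ ≐ (⟦ T ⟧ ⁽ -[1+ 0 ] ⁾))
             (T²-identity : (⟦ T ⟧ ⊗ ⟦ T ⟧) ≐ ((((+ 2) · 𝔾) ⊖ (⟦ T ⟧ ⁽ + 2 ⁾)) ⊕ ((+ (2 ℕ.* n)) · 𝕖)))
             where

      χ-⁻¹ : ∀ g → χ (g ⁻¹) ≡ χ g
      χ-⁻¹ g = sym (trans (T-symmetric g) (trans
        (∑-cong elems (λ h → if-then-0≡𝟙* ⌊ ((h ∙ e) ⁻¹) ≟ g ⌋ (χ h)))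
        (ΣG-[≈] (λ h → (h ∙ e) ⁻¹) (λ _ → g) χ (g ⁻¹) solution
                (trans (cong _⁻¹ (identityʳ (g ⁻¹))) (⁻¹-involutive g)))))
        where
          solution : ∀ h → (h ∙ e) ⁻¹ ≡ g → h ≡ g ⁻¹
          solution h h⁻¹≡g = trans (sym (⁻¹-involutive h)) (cong _⁻¹ (trans (cong _⁻¹ (sym (identityʳ h))) h⁻¹≡g))

      ΣG-χ : ΣG χ ≡ + 2 * N + 1ℤ
      ΣG-χ = begin
        ΣG χ                     ≡⟨ ∑-cong elems (if≡𝟙 ∘ T) ⟩
        ΣG (𝟙 ∘ T)               ≡⟨ sym (length-filter≡∑𝟙 T elems) ⟩
        + card T                 ≡⟨ cong +_ card-T ⟩
        + (2 ℕ.* n ℕ.+ 1)        ≡⟨ trans (pos-+ (2 ℕ.* n) 1) (cong (_+ 1ℤ) (pos-* 2 n)) ⟩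
        + 2 * N + 1ℤ             ∎
        where open ≡-Reasoning

      χ²≡ : ∀ g → χ² g ≡ + 2 - χ⁽²⁾ g + + 2 * N * [ g ≈ e ]
      χ²≡ g = trans (T²-identity g) (cong₂ (λ a b → + 2 - a + b)
        (∑-cong elems (λ h → if-then-0≡𝟙* ⌊ h ² ≟ g ⌋ (χ h)))
        (cong₂ _*_ (pos-* 2 n) (if≡𝟙 ⌊ g ≟ e ⌋)))

      χ²-e : χ² e ≡ ΣG χ
      χ²-e = ∑-cong elems (λ a →
        trans (cong (λ x → χ a * χ x) (identityʳ (a ⁻¹))) (trans (cong (χ a *_) (χ-⁻¹ a)) (χ-idem a)))

      χ⁽²⁾-e : χ⁽²⁾ e ≡ 1ℤ
      χ⁽²⁾-e = begin
        χ⁽²⁾ e                                                  ≡⟨ isolate (χ⁽²⁾ e) N ⟩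
        (+ 2 + + 2 * N) - (+ 2 - χ⁽²⁾ e + + 2 * N * 1ℤ)
                  ≡⟨ cong (λ x → (+ 2 + + 2 * N) - (+ 2 - χ⁽²⁾ e + + 2 * N * x)) (sym ([≈]-≡ refl)) ⟩
        (+ 2 + + 2 * N) - (+ 2 - χ⁽²⁾ e + + 2 * N * [ e ≈ e ])   ≡⟨ cong (_-_ (+ 2 + + 2 * N)) (sym (χ²≡ e)) ⟩
        (+ 2 + + 2 * N) - χ² e                                  ≡⟨ cong (_-_ (+ 2 + + 2 * N)) (trans χ²-e ΣG-χ) ⟩
        (+ 2 + + 2 * N) - (+ 2 * N + 1ℤ)                        ≡⟨ simplify N ⟩
        1ℤ                                                      ∎
        where
          open ≡-Reasoning
          isolate : ∀ x N → x ≡ (+ 2 + + 2 * N) - (+ 2 - x + + 2 * N * 1ℤ)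
          isolate = solve-∀
          simplify : ∀ N → (+ 2 + + 2 * N) - (+ 2 * N + 1ℤ) ≡ 1ℤ
          simplify = solve-∀

      χ²+χ⁽²⁾ : ∀ {g} → g ≢ e → χ² g + χ⁽²⁾ g ≡ + 2
      χ²+χ⁽²⁾ {g} g≢e = begin
        χ² g + χ⁽²⁾ g                                ≡⟨ cong (_+ χ⁽²⁾ g) (χ²≡ g) ⟩
        + 2 - χ⁽²⁾ g + + 2 * N * [ g ≈ e ] + χ⁽²⁾ g
                  ≡⟨ cong (λ d → + 2 - χ⁽²⁾ g + + 2 * N * d + χ⁽²⁾ g) ([≈]-≢ g≢e) ⟩
        + 2 - χ⁽²⁾ g + + 2 * N * 0ℤ + χ⁽²⁾ g          ≡⟨ cancel (χ⁽²⁾ g) N ⟩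
        + 2                                          ∎
        where
          open ≡-Reasoning
          cancel : ∀ x N → + 2 - x + + 2 * N * 0ℤ + x ≡ + 2
          cancel = solve-∀

      ²-injective-on-T : ∀ {a b} → T a ≡ true → T b ≡ true → a ² ≡ b ² → a ≡ b
      ²-injective-on-T {a} {b} a∈T b∈T a²≡b² with a ≟ b
      ... | yes a≡b = a≡b
      ... | no  a≢b = ⊥-elim (absurd (a ² ≟ e))
        where
          2≤χ⁽²⁾ : + 2 ≤ χ⁽²⁾ (a ²)
          2≤χ⁽²⁾ = subst (_≤ χ⁽²⁾ (a ²)) (cong₂ _+_ (χ⁽²⁾-term a∈T refl) (χ⁽²⁾-term b∈T (sym a²≡b²)))
            (ΣG-≥-two-terms (λ h → [≈]*χ-nonneg (h ²) (a ²) h) a≢b)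
          absurd : Dec (a ² ≡ e) → ⊥
          absurd (yes a²≡e) = 1+k≰k (subst (+ 2 ≤_) (trans (cong χ⁽²⁾ a²≡e) χ⁽²⁾-e) 2≤χ⁽²⁾)
          absurd (no  a²≢e) = 1+k≰k (subst (+ 3 ≤_) (χ²+χ⁽²⁾ a²≢e)
            (+-mono-≤ (subst (λ x → 1ℤ ≤ χ² x) (sym (²≡∙ a)) (1≤χ² a∈T a∈T)) 2≤χ⁽²⁾))

      χ⁽²⁾≤1 : ∀ g → χ⁽²⁾ g ≤ 1ℤ
      χ⁽²⁾≤1 g with χ⁽²⁾ g ℤ.≟ 0ℤ
      ... | yes χ⁽²⁾≡0 = subst (_≤ 1ℤ) (sym χ⁽²⁾≡0) (+≤+ z≤n)
      ... | no  χ⁽²⁾≢0 with ∑≢0⇒∃≢0 elems _ χ⁽²⁾≢0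
      ...   | h₀ , term≢0 = ≤-reflexive (trans (ΣG-concentrated _ h₀ only-h₀) (χ⁽²⁾-term (root term≢0) (sqrt term≢0)))
        where
          sqrt : ∀ {h} → [ h ² ≈ g ] * χ h ≢ 0ℤ → h ² ≡ g
          sqrt {h} = [≈]*≢0⇒≡ (χ h)
          root : ∀ {h} → [ h ² ≈ g ] * χ h ≢ 0ℤ → T h ≡ true
          root {h} = χ≢0⇒∈T ∘ *≢0⇒≢0ʳ [ h ² ≈ g ] (χ h)
          only-h₀ : ∀ h → [ h ² ≈ g ] * χ h ≢ 0ℤ → h ≡ h₀
          only-h₀ h term≢0′ = ²-injective-on-T (root term≢0′) (root term≢0) (trans (sqrt term≢0′) (sym (sqrt term≢0)))

      χ²≢0 : ∀ {g} → g ≢ e → χ² g ≢ 0ℤ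
      χ²≢0 {g} g≢e χ²≡0 = 1+k≰k (subst (_≤ 1ℤ) χ⁽²⁾≡2 (χ⁽²⁾≤1 g))
        where
          χ⁽²⁾≡2 : χ⁽²⁾ g ≡ + 2
          χ⁽²⁾≡2 = trans (sym (+-identityˡ (χ⁽²⁾ g))) (trans (cong (_+ χ⁽²⁾ g) (sym χ²≡0)) (χ²+χ⁽²⁾ g≢e))

      -- Write g = b c with b, c ∈ T; then b² = (c⁻¹)² with c⁻¹ ∈ T, so b = c⁻¹.
      ²≡e⇒≡e : ∀ {g} → g ² ≡ e → g ≡ e
      ²≡e⇒≡e {g} g²≡e with g ≟ e
      ... | yes g≡e = g≡e
      ... | no  g≢e with ∑≢0⇒∃≢0 elems _ (χ²≢0 g≢e)
      ...   | b , term≢0 = begin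
        g          ≡⟨ sym (\\-leftDividesˡ b g) ⟩
        b ∙ c      ≡⟨ cong (_∙ c) b≡c⁻¹ ⟩
        (c ⁻¹) ∙ c ≡⟨ inverseˡ c ⟩
        e          ∎
        where
          open ≡-Reasoning
          c = (b ⁻¹) ∙ g
          b≡c⁻¹ : b ≡ c ⁻¹
          b≡c⁻¹ = ²-injective-on-T (χ≢0⇒∈T (*≢0⇒≢0ˡ (χ b) (χ c) term≢0))
            (χ≢0⇒∈T (λ χc⁻¹≡0 → *≢0⇒≢0ʳ (χ b) (χ c) term≢0 (trans (sym (χ-⁻¹ c)) χc⁻¹≡0)))
            (trans (inverseʳ-unique (c ²) (b ²) (trans (comm (c ²) (b ²))
                     (trans (sym (²-∙ b c)) (trans (cong _² (\\-leftDividesˡ b g)) g²≡e))))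
                   (sym (²-⁻¹ c)))

      ²-injective : ∀ {x y} → x ² ≡ y ² → x ≡ y
      ²-injective {x} {y} x²≡y² = x∙y⁻¹≈ε⇒x≈y x y (²≡e⇒≡e (begin
        (x ∙ (y ⁻¹)) ²     ≡⟨ ²-∙ x (y ⁻¹) ⟩
        x ² ∙ (y ⁻¹) ²     ≡⟨ cong₂ _∙_ x²≡y² (²-⁻¹ y) ⟩
        y ² ∙ ((y ²) ⁻¹)   ≡⟨ inverseʳ (y ²) ⟩
        e                  ∎))
        where open ≡-Reasoning

      ∈T∧²∈T⇒≡e : ∀ {g} → T g ≡ true → T (g ²) ≡ true → g ≡ e
      ∈T∧²∈T⇒≡e {g} g∈T g²∈T with g ≟ e
      ... | yes g≡e = g≡e
      ... | no  g≢e = ⊥-elim (1+k≰k (subst (+ 3 ≤_) (χ²+χ⁽²⁾ g²≢e) (+-mono-≤ 2≤χ² 1≤χ⁽²⁾)))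
        where
          g²≢e : g ² ≢ e
          g²≢e = g≢e ∘ ²≡e⇒≡e
          1≤χ⁽²⁾ : 1ℤ ≤ χ⁽²⁾ (g ²)
          1≤χ⁽²⁾ = subst (_≤ χ⁽²⁾ (g ²)) (χ⁽²⁾-term g∈T refl)
            (ΣG-≥-term (λ h → [≈]*χ-nonneg (h ²) (g ²) h) g)
          -- g² = e · g² = g² · e are two factorisations in T · T.
          2≤χ² : + 2 ≤ χ² (g ²)
          2≤χ² = subst (_≤ χ² (g ²))
            (cong₂ _+_ (trans (cong (λ x → χ e * χ x) (trans (cong (_∙ g ²) ε⁻¹≈ε) (identityˡ (g ²))))
                              (cong₂ _*_ (χ≡1 e∈T) (χ≡1 g²∈T)))
                       (trans (cong (λ x → χ (g ²) * χ x) (inverseˡ (g ²)))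
                              (cong₂ _*_ (χ≡1 g²∈T) (χ≡1 e∈T))))
            (ΣG-≥-two-terms (λ a → χ*χ-nonneg a _) (g²≢e ∘ sym))

      S : Carrier → ℤ
      S = (⟦ T ⟧ ⁽ + 2 ⁾) ⊗ ⟦ T ⟧

      S-term : Carrier → Carrier → ℤ
      S-term h g = χ h * χ (((h ²) ⁻¹) ∙ g)

      S≡ΣG-S-term : ∀ g → S g ≡ ΣG (λ h → S-term h g)
      S≡ΣG-S-term g = begin
        S g                                                          ≡⟨ ∑-cong elems (λ a → cong (_* χ ((a ⁻¹) ∙ g))
                                                                          (∑-cong elems (λ h → if-then-0≡𝟙* ⌊ h ² ≟ a ⌋ (χ h)))) ⟩
        ΣG (λ a → χ⁽²⁾ a * χ ((a ⁻¹) ∙ g))                           ≡⟨ ∑-cong elems (λ a → sym (∑-distribʳ elems _ _)) ⟩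
        ΣG (λ a → ΣG (λ h → [ h ² ≈ a ] * χ h * χ ((a ⁻¹) ∙ g)))      ≡⟨ ∑-comm elems elems _ ⟩
        ΣG (λ h → ΣG (λ a → [ h ² ≈ a ] * χ h * χ ((a ⁻¹) ∙ g)))      ≡⟨ ∑-cong elems (λ h →
          trans (∑-cong elems (λ a → *-assoc [ h ² ≈ a ] (χ h) _))
                (ΣG-[≈] (λ _ → h ²) (λ a → a) (λ a → χ h * χ ((a ⁻¹) ∙ g)) (h ²) (λ _ h²≡a → sym h²≡a) refl)) ⟩
        ΣG (λ h → S-term h g)                                        ∎
        where open ≡-Reasoning

      S-nonneg : ∀ g → 0ℤ ≤ S g
      S-nonneg g = subst (0ℤ ≤_) (sym (S≡ΣG-S-term g)) (ΣG-nonneg (λ h → χ*χ-nonneg h _))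

      ΣG-S : ΣG S ≡ ΣG χ * ΣG χ
      ΣG-S = begin
        ΣG S                                          ≡⟨ ∑-cong elems S≡ΣG-S-term ⟩
        ΣG (λ g → ΣG (λ h → S-term h g))              ≡⟨ ∑-comm elems elems _ ⟩
        ΣG (λ h → ΣG (λ g → S-term h g))              ≡⟨ ∑-cong elems (λ h → trans (∑-distribˡ elems (χ h) _)
                                                           (cong (χ h *_) (ΣG-translate ((h ²) ⁻¹) χ))) ⟩
        ΣG (λ h → χ h * ΣG χ)                         ≡⟨ ∑-distribʳ elems (ΣG χ) χ ⟩
        ΣG χ * ΣG χ                                   ∎
        where open ≡-Reasoning

      private
        z : Carrier → Carrier → Carrier
        z h k = ((h ²) ⁻¹) ∙ k ²

      pair-sum : (Carrier → ℤ) → ℤ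
      pair-sum F = ΣG (λ h → ΣG (λ k → F (z h k) * (χ h * χ k)))

      ΣG-S-term-product : ∀ h k → ΣG (λ g → S-term h g * S-term k g) ≡ χ² (z h k) * (χ h * χ k)
      ΣG-S-term-product h k = begin
        ΣG (λ g → S-term h g * S-term k g)                                ≡⟨ ∑-cong elems (λ g → interchange-* (χ h) (χ k) _ _) ⟩
        ΣG (λ g → χ (((h ²) ⁻¹) ∙ g) * χ (((k ²) ⁻¹) ∙ g) * (χ h * χ k))  ≡⟨ ∑-distribʳ elems (χ h * χ k) _ ⟩
        ΣG (λ g → χ (((h ²) ⁻¹) ∙ g) * χ (((k ²) ⁻¹) ∙ g)) * (χ h * χ k)  ≡⟨ cong (_* (χ h * χ k)) (sym (ΣG-translate (h ²) _)) ⟩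
        ΣG (λ x → χ (((h ²) ⁻¹) ∙ (h ² ∙ x)) * χ (((k ²) ⁻¹) ∙ (h ² ∙ x))) * (χ h * χ k)
                                                    ≡⟨ cong (_* (χ h * χ k)) (∑-cong elems (λ x → cong₂ _*_
                                                         (cong χ (\\-leftDividesʳ (h ²) x))
                                                         (trans (sym (χ-⁻¹ _)) (cong χ (invert (k ²) (h ²) x))))) ⟩
        χ² (z h k) * (χ h * χ k)                                          ∎
        where
          open ≡-Reasoning
          interchange-* : ∀ a b c d → a * c * (b * d) ≡ c * d * (a * b)
          interchange-* = solve-∀
          invert : ∀ c b x → (((c ⁻¹) ∙ (b ∙ x)) ⁻¹) ≡ (x ⁻¹) ∙ ((b ⁻¹) ∙ c)
          invert c b x = begin
            ((c ⁻¹) ∙ (b ∙ x)) ⁻¹     ≡⟨ ⁻¹-anti-homo-\\ c (b ∙ x) ⟩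
            ((b ∙ x) ⁻¹) ∙ c          ≡⟨ cong (_∙ c) (trans (cong _⁻¹ (comm b x)) (sym (⁻¹-∙-comm x b))) ⟩
            ((x ⁻¹) ∙ (b ⁻¹)) ∙ c     ≡⟨ assoc (x ⁻¹) (b ⁻¹) c ⟩
            (x ⁻¹) ∙ ((b ⁻¹) ∙ c)     ∎

      ΣG-S²≡pair-sum : ΣG (λ g → S g * S g) ≡ pair-sum χ²
      ΣG-S²≡pair-sum = begin
        ΣG (λ g → S g * S g)                                         ≡⟨ ∑-cong elems square ⟩
        ΣG (λ g → ΣG (λ h → ΣG (λ k → S-term h g * S-term k g)))      ≡⟨ ∑-comm elems elems _ ⟩
        ΣG (λ h → ΣG (λ g → ΣG (λ k → S-term h g * S-term k g)))      ≡⟨ ∑-cong elems (λ h → ∑-comm elems elems _) ⟩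
        ΣG (λ h → ΣG (λ k → ΣG (λ g → S-term h g * S-term k g)))      ≡⟨ ∑-cong elems (λ h → ∑-cong elems (ΣG-S-term-product h)) ⟩
        pair-sum χ²                                                  ∎
        where
          open ≡-Reasoning
          square : ∀ g → S g * S g ≡ ΣG (λ h → ΣG (λ k → S-term h g * S-term k g))
          square g = begin
            S g * S g                                      ≡⟨ cong₂ _*_ (S≡ΣG-S-term g) (S≡ΣG-S-term g) ⟩
            ΣG (λ h → S-term h g) * ΣG (λ k → S-term k g)  ≡⟨ sym (∑-distribʳ elems _ _) ⟩
            ΣG (λ h → S-term h g * ΣG (λ k → S-term k g))  ≡⟨ ∑-cong elems (λ h → sym (∑-distribˡ elems (S-term h g) _)) ⟩
            ΣG (λ h → ΣG (λ k → S-term h g * S-term k g))  ∎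

      private
        distribute : ∀ p x d N → (+ 2 - x + + 2 * N * d) * p ≡ + 2 * p - x * p + + 2 * N * (d * p)
        distribute = solve-∀

      pair-sum-χ² : pair-sum χ² ≡ + 2 * (ΣG χ * ΣG χ) - pair-sum χ⁽²⁾ + + 2 * N * pair-sum [_≈ e ]
      pair-sum-χ² = begin
        pair-sum χ²                                                ≡⟨ ∑-cong elems (λ h → ∑-cong elems (λ k →
                                                                        trans (cong (_* (χ h * χ k)) (χ²≡ (z h k)))
                                                                          (distribute (χ h * χ k) (χ⁽²⁾ (z h k)) [ z h k ≈ e ] N))) ⟩
        ΣG (λ h → ΣG (λ k → + 2 * (χ h * χ k) - χ⁽²⁾ (z h k) * (χ h * χ k) + + 2 * N * ([ z h k ≈ e ] * (χ h * χ k))))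
                                                                   ≡⟨ ∑-cong elems (λ h → ∑-linear elems _ _ _ (+ 2) (+ 2 * N)) ⟩
        ΣG (λ h → + 2 * ΣG (λ k → χ h * χ k) - ΣG (λ k → χ⁽²⁾ (z h k) * (χ h * χ k))
                    + + 2 * N * ΣG (λ k → [ z h k ≈ e ] * (χ h * χ k)))
                                                                   ≡⟨ ∑-linear elems _ _ _ (+ 2) (+ 2 * N) ⟩
        + 2 * ΣG (λ h → ΣG (λ k → χ h * χ k)) - pair-sum χ⁽²⁾ + + 2 * N * pair-sum [_≈ e ]
                                                                   ≡⟨ cong (λ x → + 2 * x - pair-sum χ⁽²⁾ + + 2 * N * pair-sum [_≈ e ])
                                                                        (trans (∑-cong elems (λ h → ∑-distribˡ elems (χ h) χ))
                                                                               (∑-distribʳ elems (ΣG χ) χ)) ⟩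
        + 2 * (ΣG χ * ΣG χ) - pair-sum χ⁽²⁾ + + 2 * N * pair-sum [_≈ e ] ∎
        where open ≡-Reasoning

      pair-sum-[≈e] : pair-sum [_≈ e ] ≡ ΣG χ
      pair-sum-[≈e] = ∑-cong elems (λ h →
        trans (ΣG-[≈] (z h) (λ _ → e) (λ k → χ h * χ k) h
                      (λ k z≡e → ²-injective (trans (inverseʳ-unique _ _ z≡e) (⁻¹-involutive (h ²))))
                      (inverseˡ (h ²)))
              (χ-idem h))

      ΣG-χ⁽²⁾⁻¹*χ : ΣG (λ h → χ⁽²⁾ (h ⁻¹) * χ h) ≡ 1ℤ
      ΣG-χ⁽²⁾⁻¹*χ = begin
        ΣG (λ h → χ⁽²⁾ (h ⁻¹) * χ h)                          ≡⟨ ∑-cong elems (λ h → sym (∑-distribʳ elems (χ h) _)) ⟩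
        ΣG (λ h → ΣG (λ m → [ m ² ≈ h ⁻¹ ] * χ m * χ h))       ≡⟨ ∑-comm elems elems _ ⟩
        ΣG (λ m → ΣG (λ h → [ m ² ≈ h ⁻¹ ] * χ m * χ h))       ≡⟨ ∑-cong elems (λ m →
          trans (∑-cong elems (λ h → *-assoc [ m ² ≈ h ⁻¹ ] (χ m) (χ h)))
                (ΣG-[≈] (λ _ → m ²) _⁻¹ (λ h → χ m * χ h) ((m ²) ⁻¹)
                        (λ h m²≡h⁻¹ → trans (sym (⁻¹-involutive h)) (cong _⁻¹ (sym m²≡h⁻¹)))
                        (sym (⁻¹-involutive (m ²))))) ⟩
        ΣG (λ m → χ m * χ ((m ²) ⁻¹))                          ≡⟨ ∑-cong elems (λ m → cong (χ m *_) (χ-⁻¹ (m ²))) ⟩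
        ΣG (λ m → χ m * χ (m ²))                               ≡⟨ ΣG-concentrated _ e only-e ⟩
        χ e * χ (e ²)                                          ≡⟨ cong₂ _*_ (χ≡1 e∈T) (trans (cong χ e²) (χ≡1 e∈T)) ⟩
        1ℤ                                                     ∎
        where
          open ≡-Reasoning
          only-e : ∀ m → χ m * χ (m ²) ≢ 0ℤ → m ≡ e
          only-e m term≢0 = ∈T∧²∈T⇒≡e (χ≢0⇒∈T (*≢0⇒≢0ˡ (χ m) (χ (m ²)) term≢0))
                                      (χ≢0⇒∈T (*≢0⇒≢0ʳ (χ m) (χ (m ²)) term≢0))

      ΣG-[⁻¹≈e]*χ : ΣG (λ h → [ h ⁻¹ ≈ e ] * χ h) ≡ 1ℤ
      ΣG-[⁻¹≈e]*χ = trans (ΣG-[≈] _⁻¹ (λ _ → e) χ e (λ h h⁻¹≡e → ⁻¹-injective (trans h⁻¹≡e (sym ε⁻¹≈ε))) ε⁻¹≈ε)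
                          (χ≡1 e∈T)

      -- For fixed m, the term [ m² ≈ z h k ] selects k = h m, since squaring is injective.
      pair-sum-χ⁽²⁾-row : ∀ h → ΣG (λ k → χ⁽²⁾ (z h k) * (χ h * χ k)) ≡ χ² (h ⁻¹) * χ h
      pair-sum-χ⁽²⁾-row h = begin
        ΣG (λ k → χ⁽²⁾ (z h k) * (χ h * χ k))                    ≡⟨ ∑-cong elems (λ k → sym (∑-distribʳ elems _ _)) ⟩
        ΣG (λ k → ΣG (λ m → [ m ² ≈ z h k ] * χ m * (χ h * χ k)))  ≡⟨ ∑-comm elems elems _ ⟩
        ΣG (λ m → ΣG (λ k → [ m ² ≈ z h k ] * χ m * (χ h * χ k)))  ≡⟨ ∑-cong elems (λ m →
          trans (∑-cong elems (λ k → regroup [ m ² ≈ z h k ] (χ m) (χ h) (χ k)))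
                (ΣG-[≈] (λ _ → m ²) (z h) (λ k → χ m * χ k * χ h) (h ∙ m) (solution m) (sym (z-hm m)))) ⟩
        ΣG (λ m → χ m * χ (h ∙ m) * χ h)                         ≡⟨ ∑-cong elems (λ m → cong (λ x → χ m * x * χ h) (χ-hm m)) ⟩
        ΣG (λ m → χ m * χ ((m ⁻¹) ∙ (h ⁻¹)) * χ h)               ≡⟨ ∑-distribʳ elems (χ h) _ ⟩
        χ² (h ⁻¹) * χ h                                          ∎
        where
          open ≡-Reasoning
          regroup : ∀ a b c d → a * b * (c * d) ≡ a * (b * d * c)
          regroup = solve-∀
          z-hm : ∀ m → z h (h ∙ m) ≡ m ²
          z-hm m = trans (cong (((h ²) ⁻¹) ∙_) (²-∙ h m)) (\\-leftDividesʳ (h ²) (m ²))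
          solution : ∀ m k → m ² ≡ z h k → k ≡ h ∙ m
          solution m k m²≡z = ²-injective (trans (sym (\\-leftDividesˡ (h ²) (k ²)))
                                                 (trans (cong (h ² ∙_) (sym m²≡z)) (sym (²-∙ h m))))
          χ-hm : ∀ m → χ (h ∙ m) ≡ χ ((m ⁻¹) ∙ (h ⁻¹))
          χ-hm m = trans (sym (χ-⁻¹ (h ∙ m))) (cong χ (trans (cong _⁻¹ (comm h m)) (sym (⁻¹-∙-comm m h))))

      pair-sum-χ⁽²⁾ : pair-sum χ⁽²⁾ ≡ + 2 * ΣG χ - 1ℤ + + 2 * N * 1ℤ
      pair-sum-χ⁽²⁾ = begin
        pair-sum χ⁽²⁾                                             ≡⟨ ∑-cong elems pair-sum-χ⁽²⁾-row ⟩
        ΣG (λ h → χ² (h ⁻¹) * χ h)                                ≡⟨ ∑-cong elems (λ h → trans (cong (_* χ h) (χ²≡ (h ⁻¹)))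
                                                                     (distribute (χ h) (χ⁽²⁾ (h ⁻¹)) [ h ⁻¹ ≈ e ] N)) ⟩
        ΣG (λ h → + 2 * χ h - χ⁽²⁾ (h ⁻¹) * χ h + + 2 * N * ([ h ⁻¹ ≈ e ] * χ h))
                                                                  ≡⟨ ∑-linear elems _ _ _ (+ 2) (+ 2 * N) ⟩
        + 2 * ΣG χ - ΣG (λ h → χ⁽²⁾ (h ⁻¹) * χ h) + + 2 * N * ΣG (λ h → [ h ⁻¹ ≈ e ] * χ h)
                                                                  ≡⟨ cong₂ (λ q r → + 2 * ΣG χ - q + + 2 * N * r)
                                                                       ΣG-χ⁽²⁾⁻¹*χ ΣG-[⁻¹≈e]*χ ⟩
        + 2 * ΣG χ - 1ℤ + + 2 * N * 1ℤ                            ∎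
        where open ≡-Reasoning

      ΣG-S² : ΣG (λ g → S g * S g) ≡ + 12 * N * N + + 4 * N + 1ℤ
      ΣG-S² = begin
        ΣG (λ g → S g * S g)                                       ≡⟨ trans ΣG-S²≡pair-sum pair-sum-χ² ⟩
        + 2 * (ΣG χ * ΣG χ) - pair-sum χ⁽²⁾ + + 2 * N * pair-sum [_≈ e ]
                                                                   ≡⟨ cong₂ (λ q r → + 2 * (ΣG χ * ΣG χ) - q + + 2 * N * r)
                                                                        pair-sum-χ⁽²⁾ pair-sum-[≈e] ⟩
        + 2 * (ΣG χ * ΣG χ) - (+ 2 * ΣG χ - 1ℤ + + 2 * N * 1ℤ) + + 2 * N * ΣG χ
                                                                   ≡⟨ cong (λ σ → + 2 * (σ * σ) - (+ 2 * σ - 1ℤ + + 2 * N * 1ℤ) + + 2 * N * σ)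
                                                                        ΣG-χ ⟩
        + 2 * ((+ 2 * N + 1ℤ) * (+ 2 * N + 1ℤ)) - (+ 2 * (+ 2 * N + 1ℤ) - 1ℤ + + 2 * N * 1ℤ) + + 2 * N * (+ 2 * N + 1ℤ)
                                                                   ≡⟨ simplify N ⟩
        + 12 * N * N + + 4 * N + 1ℤ                                ∎
        where
          open ≡-Reasoning
          simplify : ∀ N → + 2 * ((+ 2 * N + 1ℤ) * (+ 2 * N + 1ℤ)) - (+ 2 * (+ 2 * N + 1ℤ) - 1ℤ + + 2 * N * 1ℤ)
                             + + 2 * N * (+ 2 * N + 1ℤ) ≡ + 12 * N * N + + 4 * N + 1ℤ
          simplify = solve-∀

      χ³ : Carrier → ℤ
      χ³ = χ² ⊗ χ

      χ⁽³⁾ : Carrier → ℤ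
      χ⁽³⁾ g = ΣG (λ b → [ b ∙ (b ∙ b) ≈ g ] * χ b)

      S≡ΣG-χ-χ³ : ∀ g → S g ≡ + 2 * ΣG χ - χ³ g + + 2 * N * χ g
      S≡ΣG-χ-χ³ g = begin
        S g                                                    ≡⟨ ∑-cong elems (λ a → cong (_* χ ((a ⁻¹) ∙ g))
                                                                    (trans (∑-cong elems (λ h → if-then-0≡𝟙* ⌊ h ² ≟ a ⌋ (χ h))) (χ⁽²⁾≡ a))) ⟩
        ΣG (λ a → (+ 2 - χ² a + + 2 * N * [ a ≈ e ]) * χ ((a ⁻¹) ∙ g))
                                                               ≡⟨ ∑-cong elems (λ a → distribute (χ ((a ⁻¹) ∙ g)) (χ² a) [ a ≈ e ] N) ⟩
        ΣG (λ a → + 2 * χ ((a ⁻¹) ∙ g) - χ² a * χ ((a ⁻¹) ∙ g) + + 2 * N * ([ a ≈ e ] * χ ((a ⁻¹) ∙ g)))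
                                                               ≡⟨ ∑-linear elems _ _ _ (+ 2) (+ 2 * N) ⟩
        + 2 * ΣG (λ a → χ ((a ⁻¹) ∙ g)) - χ³ g + + 2 * N * ΣG (λ a → [ a ≈ e ] * χ ((a ⁻¹) ∙ g))
                                                               ≡⟨ cong₂ (λ x y → + 2 * x - χ³ g + + 2 * N * y)
                                                                    (ΣG-reindex (λ a → (a ⁻¹) ∙ g) (λ a → (a ⁻¹) ∙ g) involution involution χ)
                                                                    (ΣG-[≈] (λ a → a) (λ _ → e) (λ a → χ ((a ⁻¹) ∙ g)) e (λ _ a≡e → a≡e) refl) ⟩
        + 2 * ΣG χ - χ³ g + + 2 * N * χ ((e ⁻¹) ∙ g)           ≡⟨ cong (λ x → + 2 * ΣG χ - χ³ g + + 2 * N * χ x)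
                                                                    (trans (cong (_∙ g) ε⁻¹≈ε) (identityˡ g)) ⟩
        + 2 * ΣG χ - χ³ g + + 2 * N * χ g                      ∎
        where
          open ≡-Reasoning
          χ⁽²⁾≡ : ∀ a → χ⁽²⁾ a ≡ + 2 - χ² a + + 2 * N * [ a ≈ e ]
          χ⁽²⁾≡ a = trans (swap (χ⁽²⁾ a) (+ 2 * N * [ a ≈ e ])) (cong (λ y → + 2 - y + + 2 * N * [ a ≈ e ]) (sym (χ²≡ a)))
            where
              swap : ∀ x c → x ≡ + 2 - (+ 2 - x + c) + c
              swap = solve-∀
          involution : ∀ a → (((a ⁻¹) ∙ g) ⁻¹) ∙ g ≡ a
          involution a = begin
            (((a ⁻¹) ∙ g) ⁻¹) ∙ g     ≡⟨ cong (_∙ g) (⁻¹-anti-homo-\\ a g) ⟩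
            ((g ⁻¹) ∙ a) ∙ g          ≡⟨ cong (_∙ g) (comm (g ⁻¹) a) ⟩
            (a ∙ (g ⁻¹)) ∙ g          ≡⟨ assoc a (g ⁻¹) g ⟩
            a ∙ ((g ⁻¹) ∙ g)          ≡⟨ cong (a ∙_) (inverseˡ g) ⟩
            a ∙ e                     ≡⟨ identityʳ a ⟩
            a                         ∎

      χ³≡∑³ : ∀ g → χ³ g ≡ ∑³ elems (λ b c d → χ b * χ c * χ d * [ b ∙ (c ∙ d) ≈ g ])
      χ³≡∑³ g = begin
        ΣG (λ a → χ² a * χ ((a ⁻¹) ∙ g))                                ≡⟨ ∑-cong elems (λ a → sym (∑-distribʳ elems _ _)) ⟩
        ΣG (λ a → ΣG (λ b → χ b * χ ((b ⁻¹) ∙ a) * χ ((a ⁻¹) ∙ g)))      ≡⟨ ∑-comm elems elems _ ⟩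
        ΣG (λ b → ΣG (λ a → χ b * χ ((b ⁻¹) ∙ a) * χ ((a ⁻¹) ∙ g)))      ≡⟨ ∑-cong elems (λ b → sym (ΣG-translate b _)) ⟩
        ΣG (λ b → ΣG (λ c → χ b * χ ((b ⁻¹) ∙ (b ∙ c)) * χ (((b ∙ c) ⁻¹) ∙ g)))
                                                    ≡⟨ ∑-cong elems (λ b → ∑-cong elems (λ c →
                                                         cong₂ (λ x y → χ b * χ x * y) (\\-leftDividesʳ b c) (sym (last-factor b c)))) ⟩
        ΣG (λ b → ΣG (λ c → χ b * χ c * ΣG (λ d → [ b ∙ (c ∙ d) ≈ g ] * χ d)))
                                                    ≡⟨ ∑-cong elems (λ b → ∑-cong elems (λ c → trans (sym (∑-distribˡ elems (χ b * χ c) _))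
                                                         (∑-cong elems (λ d → rotate (χ b * χ c) [ b ∙ (c ∙ d) ≈ g ] (χ d))))) ⟩
        ∑³ elems (λ b c d → χ b * χ c * χ d * [ b ∙ (c ∙ d) ≈ g ])       ∎
        where
          open ≡-Reasoning
          rotate : ∀ p x y → p * (x * y) ≡ p * y * x
          rotate = solve-∀
          last-factor : ∀ b c → ΣG (λ d → [ b ∙ (c ∙ d) ≈ g ] * χ d) ≡ χ (((b ∙ c) ⁻¹) ∙ g)
          last-factor b c = ΣG-[≈] (λ d → b ∙ (c ∙ d)) (λ _ → g) χ (((b ∙ c) ⁻¹) ∙ g)
            (λ d bcd≡g → y≈x\\z (b ∙ c) d g (trans (assoc b c d) bcd≡g))
            (trans (sym (assoc b c _)) (\\-leftDividesˡ (b ∙ c) g))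

      χ³≡χ⁽³⁾-mod-3 : ∀ g → ∃[ k ] χ³ g ≡ χ⁽³⁾ g + + 3 * k
      χ³≡χ⁽³⁾-mod-3 g = map₂ (λ {k} eq → trans (χ³≡∑³ g) (trans eq (cong (_+ + 3 * k) (∑-cong elems diagonal))))
        (∑³-symmetric≡diagonal-mod-3 w swap₁₂ swap₂₃ elems)
        where
          w : Carrier → Carrier → Carrier → ℤ
          w b c d = χ b * χ c * χ d * [ b ∙ (c ∙ d) ≈ g ]
          swap₁₂ : ∀ b c d → w b c d ≡ w c b d
          swap₁₂ b c d = cong₂ _*_ (cong (_* χ d) (*-comm (χ b) (χ c))) (cong ([_≈ g ]) (x∙yz≈y∙xz b c d))
          swap₂₃ : ∀ b c d → w b c d ≡ w b d c
          swap₂₃ b c d = cong₂ _*_ (trans (*-assoc (χ b) (χ c) (χ d)) (trans (cong (χ b *_) (*-comm (χ c) (χ d)))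
                                          (sym (*-assoc (χ b) (χ d) (χ c)))))
                                   (cong ([_≈ g ]) (x∙yz≈x∙zy b c d))
          diagonal : ∀ b → w b b b ≡ [ b ∙ (b ∙ b) ≈ g ] * χ b
          diagonal b = trans (cong (_* [ b ∙ (b ∙ b) ≈ g ]) (trans (cong (_* χ b) (χ-idem b)) (χ-idem b)))
                             (*-comm (χ b) _)

      ΣG-χ⁽³⁾ : ΣG χ⁽³⁾ ≡ ΣG χ
      ΣG-χ⁽³⁾ = trans (∑-comm elems elems _)
        (∑-cong elems (λ b → ΣG-[≈] (λ _ → b ∙ (b ∙ b)) (λ g → g) (λ _ → χ b) (b ∙ (b ∙ b)) (λ _ eq → sym eq) refl))

      χ⁽³⁾-nonneg : ∀ g → 0ℤ ≤ χ⁽³⁾ g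
      χ⁽³⁾-nonneg g = ΣG-nonneg (λ b → [≈]*χ-nonneg (b ∙ (b ∙ b)) g b)

      1≤χ⁽³⁾-e : 1ℤ ≤ χ⁽³⁾ e
      1≤χ⁽³⁾-e = subst (_≤ χ⁽³⁾ e) (cong₂ _*_ ([≈]-≡ (trans (identityˡ (e ∙ e)) (identityˡ e))) (χ≡1 e∈T))
        (ΣG-≥-term (λ b → [≈]*χ-nonneg (b ∙ (b ∙ b)) e b) e)

      ΣG-c : ΣG (λ g → χ g + χ⁽³⁾ g) ≡ + 2 * (+ 2 * N + 1ℤ)
      ΣG-c = trans (∑-distrib-+ elems χ χ⁽³⁾) (trans (cong₂ _+_ ΣG-χ (trans ΣG-χ⁽³⁾ ΣG-χ)) (double _))
        where
          double : ∀ x → x + x ≡ + 2 * x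
          double = solve-∀

      S-moments : ΣG (λ g → S g * S g) + + 2 * ΣG (λ g → χ g + χ⁽³⁾ g) ≡ + 3 * ΣG S + + 2
      S-moments = begin
        ΣG (λ g → S g * S g) + + 2 * ΣG (λ g → χ g + χ⁽³⁾ g)   ≡⟨ cong₂ (λ p c → p + + 2 * c) ΣG-S² ΣG-c ⟩
        + 12 * N * N + + 4 * N + 1ℤ + + 2 * (+ 2 * (+ 2 * N + 1ℤ)) ≡⟨ simplify N ⟩
        + 3 * ((+ 2 * N + 1ℤ) * (+ 2 * N + 1ℤ)) + + 2           ≡⟨ cong (λ x → + 3 * x + + 2) (sym (trans ΣG-S (cong₂ _*_ ΣG-χ ΣG-χ))) ⟩
        + 3 * ΣG S + + 2                                       ∎
        where
          open ≡-Reasoning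
          simplify : ∀ N → + 12 * N * N + + 4 * N + 1ℤ + + 2 * (+ 2 * (+ 2 * N + 1ℤ))
                         ≡ + 3 * ((+ 2 * N + 1ℤ) * (+ 2 * N + 1ℤ)) + + 2
          simplify = solve-∀

      module Counting (n%3≡1 : n ℕ.% 3 ≡ 1) where

        private
          Q : ℤ
          Q = + (n / 3)

          N≡1+3Q : N ≡ 1ℤ + + 3 * Q
          N≡1+3Q = begin
            + n                            ≡⟨ cong +_ (trans (m≡m%n+[m/n]*n n 3) (cong (ℕ._+ (n / 3) ℕ.* 3) n%3≡1)) ⟩
            + (1 ℕ.+ (n / 3) ℕ.* 3)        ≡⟨ pos-+ 1 _ ⟩
            1ℤ + + ((n / 3) ℕ.* 3)         ≡⟨ cong (λ x → 1ℤ + x) (trans (pos-* (n / 3) 3) (*-comm Q (+ 3))) ⟩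
            1ℤ + + 3 * Q                   ∎
            where open ≡-Reasoning

        S≡2[χ+χ⁽³⁾]-mod-3 : ∀ g → ∃[ j ] S g ≡ + 2 * (χ g + χ⁽³⁾ g) + + 3 * j
        S≡2[χ+χ⁽³⁾]-mod-3 g with χ³≡χ⁽³⁾-mod-3 g
        ... | k , χ³≡ = + 2 + + 4 * Q + + 2 * Q * χ g - χ⁽³⁾ g - k , (begin
          S g                                                           ≡⟨ S≡ΣG-χ-χ³ g ⟩
          + 2 * ΣG χ - χ³ g + + 2 * N * χ g                              ≡⟨ cong₂ (λ σ x → + 2 * σ - x + + 2 * N * χ g) ΣG-χ χ³≡ ⟩
          + 2 * (+ 2 * N + 1ℤ) - (χ⁽³⁾ g + + 3 * k) + + 2 * N * χ g       ≡⟨ cong (λ ν → + 2 * (+ 2 * ν + 1ℤ) - (χ⁽³⁾ g + + 3 * k) + + 2 * ν * χ g)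
                                                                             N≡1+3Q ⟩
          + 2 * (+ 2 * (1ℤ + + 3 * Q) + 1ℤ) - (χ⁽³⁾ g + + 3 * k) + + 2 * (1ℤ + + 3 * Q) * χ g
                                                                        ≡⟨ regroup Q (χ g) (χ⁽³⁾ g) k ⟩
          + 2 * (χ g + χ⁽³⁾ g) + + 3 * (+ 2 + + 4 * Q + + 2 * Q * χ g - χ⁽³⁾ g - k) ∎)
          where
            open ≡-Reasoning
            regroup : ∀ Q x y k → + 2 * (+ 2 * (1ℤ + + 3 * Q) + 1ℤ) - (y + + 3 * k) + + 2 * (1ℤ + + 3 * Q) * x
                                ≡ + 2 * (x + y) + + 3 * (+ 2 + + 4 * Q + + 2 * Q * x - y - k)
            regroup = solve-∀

        open ValueDistribution 𝒢 S (λ g → χ g + χ⁽³⁾ g) S-nonneg (λ g → +-mono-≤ (χ-nonneg g) (χ⁽³⁾-nonneg g))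
          S≡2[χ+χ⁽³⁾]-mod-3 (+-mono-≤ (≤-reflexive (sym (χ≡1 e∈T))) 1≤χ⁽³⁾-e) S-moments public

        count-2≡4N : count 2 ≡ + 4 * N
        count-2≡4N = trans count-2 (trans (cong (_- + 2) ΣG-c) (simplify N))
          where
            simplify : ∀ N → + 2 * (+ 2 * N + 1ℤ) - + 2 ≡ + 4 * N
            simplify = solve-∀

        three-count-3 : + 3 * count 3 ≡ + 4 * N * N - + 4 * N
        three-count-3 = begin
          + 3 * count 3                                                    ≡⟨ isolate (count 1) (count 2) (count 3) ⟩
          (count 1 + + 2 * count 2 + + 3 * count 3) - count 1 - + 2 * count 2 ≡⟨ cong (λ x → x - count 1 - + 2 * count 2) (sym ΣG-S≡counts) ⟩
          ΣG S - count 1 - + 2 * count 2                                   ≡⟨ cong₂ (λ a b → ΣG S - a - + 2 * b) count-1 count-2≡4N ⟩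
          ΣG S - 1ℤ - + 2 * (+ 4 * N)                                      ≡⟨ cong (λ x → x - 1ℤ - + 2 * (+ 4 * N))
                                                                                (trans ΣG-S (cong₂ _*_ ΣG-χ ΣG-χ)) ⟩
          (+ 2 * N + 1ℤ) * (+ 2 * N + 1ℤ) - 1ℤ - + 2 * (+ 4 * N)           ≡⟨ simplify N ⟩
          + 4 * N * N - + 4 * N                                            ∎
          where
            open ≡-Reasoning
            isolate : ∀ a b c → + 3 * c ≡ (a + + 2 * b + + 3 * c) - a - + 2 * b
            isolate = solve-∀
            simplify : ∀ N → (+ 2 * N + 1ℤ) * (+ 2 * N + 1ℤ) - 1ℤ - + 2 * (+ 4 * N) ≡ + 4 * N * N - + 4 * N
            simplify = solve-∀

        three-count-0 : order ≡ 2 ℕ.* n ℕ.* n ℕ.+ 2 ℕ.* n ℕ.+ 1 → + 3 * count 0 ≡ + 2 * N * N - + 2 * N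
        three-count-0 order≡ = begin
          + 3 * count 0                         ≡⟨ isolate (count 0) (count 1) (count 2) (count 3) ⟩
          + 3 * (count 0 + count 1 + count 2 + count 3) - + 3 * count 1 - + 3 * count 2 - + 3 * count 3
                                                ≡⟨ cong (λ x → + 3 * x - + 3 * count 1 - + 3 * count 2 - + 3 * count 3) (sym order≡counts) ⟩
          + 3 * + order - + 3 * count 1 - + 3 * count 2 - + 3 * count 3
                                                ≡⟨ cong₂ (λ x y → + 3 * x - + 3 * y - + 3 * count 2 - + 3 * count 3) +order≡ count-1 ⟩
          + 3 * (+ 2 * N * N + + 2 * N + 1ℤ) - + 3 * 1ℤ - + 3 * count 2 - + 3 * count 3
                                                ≡⟨ cong₂ (λ x y → + 3 * (+ 2 * N * N + + 2 * N + 1ℤ) - + 3 * 1ℤ - + 3 * x - y)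
                                                     count-2≡4N three-count-3 ⟩
          + 3 * (+ 2 * N * N + + 2 * N + 1ℤ) - + 3 * 1ℤ - + 3 * (+ 4 * N) - (+ 4 * N * N - + 4 * N)
                                                ≡⟨ simplify N ⟩
          + 2 * N * N - + 2 * N                 ∎
          where
            open ≡-Reasoning
            isolate : ∀ a b c d → + 3 * a ≡ + 3 * (a + b + c + d) - + 3 * b - + 3 * c - + 3 * d
            isolate = solve-∀
            simplify : ∀ N → + 3 * (+ 2 * N * N + + 2 * N + 1ℤ) - + 3 * 1ℤ - + 3 * (+ 4 * N) - (+ 4 * N * N - + 4 * N)
                           ≡ + 2 * N * N - + 2 * N
            simplify = solve-∀
            +order≡ : + order ≡ + 2 * N * N + + 2 * N + 1ℤ
            +order≡ = trans (cong +_ order≡) (trans (pos-+ _ 1) (cong (_+ 1ℤ) (trans (pos-+ (2 ℕ.* n ℕ.* n) _)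
              (cong₂ _+_ (trans (pos-* (2 ℕ.* n) n) (cong (_* N) (pos-* 2 n))) (pos-* 2 n)))))

        +card-X≡count : ∀ i → + card (X S i) ≡ count i
        +card-X≡count i = length-filter≡∑𝟙 (X S i) elems

        card-X₁ : card (X S 1) ≡ 1
        card-X₁ = +-injective (trans (+card-X≡count 1) count-1)

        card-X₂ : card (X S 2) ≡ 4 ℕ.* n
        card-X₂ = +-injective (trans (+card-X≡count 2) (trans count-2≡4N (sym (pos-* 4 n))))

        card-X₃ : 3 ℕ.* card (X S 3) ≡ 4 ℕ.* n ℕ.* (n ℕ.∸ 1)
        card-X₃ = 3*-injective (+card-X≡count 3) (trans three-count-3 (k*n*n-k*n≡k*n*[n∸1] 4 n))

        card-X₀ : order ≡ 2 ℕ.* n ℕ.* n ℕ.+ 2 ℕ.* n ℕ.+ 1 → 3 ℕ.* card (X S 0) ≡ 2 ℕ.* n ℕ.* (n ℕ.∸ 1)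
        card-X₀ order≡ = 3*-injective (+card-X≡count 0) (trans (three-count-0 order≡) (k*n*n-k*n≡k*n*[n∸1] 2 n))

open import Data.Bool using (true; false)
open import Data.Nat using (ℕ; _+_; _*_; _∸_; _≥_; _%_)
open import Data.Integer using (+_; -[1+_])
open import Relation.Binary.PropositionalEquality using (_≡_)
open import Data.Product using (_×_; _,_)

lemma3p4 : (n : ℕ) → n ≥ 2 → n % 3 ≡ 1 →
    (𝒢 : FiniteAbelianGroup) → let open FiniteAbelianGroup 𝒢 in
    order ≡ 2 * n * n + 2 * n + 1 →
    (T : Subset) → ∣ T ∣ ≡ 2 * n + 1 →
    T e ≡ true →
    ⟦ T ⟧ ≐ (⟦ T ⟧ ⁽ -[1+ 0 ] ⁾) →
    (⟦ T ⟧ ⊗ ⟦ T ⟧) ≐ ((((+ 2) · 𝔾) ⊖ (⟦ T ⟧ ⁽ + 2 ⁾)) ⊕ ((+ (2 * n)) · 𝕖)) →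
    let S = (⟦ T ⟧ ⁽ + 2 ⁾) ⊗ ⟦ T ⟧ in
    (∀ i → i ≥ 4 → ∀ g → X S i g ≡ false)
    × (3 * ∣ X S 3 ∣ ≡ 4 * n * (n ∸ 1))
    × (3 * ∣ X S 0 ∣ ≡ 2 * n * (n ∸ 1))
    × (∣ X S 2 ∣ ≡ 4 * n)
    × (∣ X S 1 ∣ ≡ 1)
lemma3p4 n _ n%3≡1 𝒢 order≡ T card-T e∈T T-symmetric T²-identity =
  no-value-≥4 , card-X₃ , card-X₀ order≡ , card-X₂ , card-X₁
  where
    open Notation 𝒢 n T
    open Consequences card-T e∈T T-symmetric T²-identity
    open Counting n%3≡1
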